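{- For $n\ge 4$ and $p\in[0,1]$, the expected number of triangles in $\mathbb{G}(n,p\, ; \,\binom{[n]}{4})$ is equal to \[ \binom{n}{3}\cdot \left\{ \left(1- \sum_{i=0}^{2} p_{0i}^{(n-3)}\right) + \sum_{i=0}^{2} p_{0i}^{(n-3)} \cdot \left(\mathbb{P}\left( \textit{Bin}\left(\binom{n-3}{2}, \frac{p}{6} \right)\ge 1 \right)\right)^{3-i} \right\}, \] where $p_{0i}^{(n-3)}$, $i=0,1,2$, is the $(0,i)$-th entry of $P^{n-3}$, and $P$ is the transition matrix, on the state space $\{0,1,2,3\}$ (rows and columns indexed $0,1,2,3$), given by \[ P=\begin{pmatrix} 1-p/2 & p/2 & 0 & 0\\ 0 & 1-p/3 & p/3 & 0\\ 0&0&1-p/6 & p/6\\ 0&0&0&1\end{pmatrix}. \]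
   Context: $\binom{[n]}{4}$ denotes the collection of all 4-element subsets of $[n]=\{1,\dots,n\}$. For $p\in[0,1]$, the random multigraph $\mathbb{G}(n,p\,;\,\binom{[n]}{4})$ is generated as follows: start with the empty graph on vertex set $[n]$; for every $H\in\binom{[n]}{4}$, choose a 2-element subset $\{i,j\}\subset H$ uniformly at random and then add an edge between $i$ and $j$ with probability $p$; all choices and coin flips are mutually independent. A triangle in a multigraph on $[n]$ is a set $T$ of three vertices such that every pair of vertices of $T$ is joined by at least one edge. $\textit{Bin}(m,r)$ denotes a binomial random variable with $m$ trials and success probability $r$.
   Formalization: The parameter p takes only rational values in $[0,1]$. -}

module Defs where

open import Data.Bool using (Bool; true; false; if_then_else_; _∧_; _∨_)
open import Data.Nat as ℕ using (ℕ; zero; suc; _<ᵇ_; _≡ᵇ_)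
open import Data.Nat.Combinatorics using (_C_)
open import Data.Integer using (+_)
open import Data.List using (List; []; _∷_; _++_; concatMap; upTo; map; filter; length; foldr)
open import Data.Bool.ListAction using (any)
open import Data.Product using (_×_; _,_)
open import Data.Fin using (Fin; zero; suc)
import Data.Fin
open import Data.Rational using (ℚ; 0ℚ; 1ℚ; _+_; _*_; _-_; _/_)

ℕtoℚ : ℕ → ℚ
ℕtoℚ n = + n / 1

_^ℚ_ : ℚ → ℕ → ℚ
x ^ℚ zero = 1ℚ
x ^ℚ suc k = x * (x ^ℚ k)

[_] : ℕ → List ℕ
[ n ] = map suc (upTo n)

Quad : Set
Quad = ℕ × ℕ × ℕ × ℕ

Edge : Set
Edge = ℕ × ℕ

quads : ℕ → List Quad
quads n =
  concatMap (λ a → concatMap (λ b → concatMap (λ c → concatMap (λ d →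
    if (a <ᵇ b) ∧ (b <ᵇ c) ∧ (c <ᵇ d) then (a , b , c , d) ∷ [] else [])
    [ n ]) [ n ]) [ n ]) [ n ]

pairOf : Quad → Fin 6 → Edge
pairOf (a , b , c , d) zero = (a , b)
pairOf (a , b , c , d) (suc zero) = (a , c)
pairOf (a , b , c , d) (suc (suc zero)) = (a , d)
pairOf (a , b , c , d) (suc (suc (suc zero))) = (b , c)
pairOf (a , b , c , d) (suc (suc (suc (suc zero)))) = (b , d)
pairOf (a , b , c , d) (suc (suc (suc (suc (suc zero))))) = (c , d)

allFin6 : List (Fin 6)
allFin6 = zero ∷ suc zero ∷ suc (suc zero) ∷ suc (suc (suc zero))
        ∷ suc (suc (suc (suc zero))) ∷ suc (suc (suc (suc (suc zero)))) ∷ []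

sumℚ : List ℚ → ℚ
sumℚ = foldr _+_ 0ℚ

-- Expectation of a function of the edge multiset (a multigraph on [n],
-- given as the list of its edges with multiplicity) under the random
-- experiment: independently for each 4-set H, a pair of H is chosen
-- uniformly (probability 1/6 each) and a coin with success
-- probability p decides whether the edge is added.
expectOver : ℚ → List Quad → (List Edge → ℚ) → ℚ
expectOver p [] f = f []
expectOver p (H ∷ Hs) f =
  sumℚ (map (λ k →
    (+ 1 / 6) * (p * expectOver p Hs (λ es → f (pairOf H k ∷ es)))
    + (+ 1 / 6) * ((1ℚ - p) * expectOver p Hs f)) allFin6)

expectG : ℕ → ℚ → (List Edge → ℚ) → ℚ
expectG n p X = expectOver p (quads n) X

joined : List Edge → ℕ → ℕ → Bool
joined es i j = any (λ e → edgeIs e) es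
  where
  edgeIs : Edge → Bool
  edgeIs (u , v) = ((u ≡ᵇ i) ∧ (v ≡ᵇ j)) ∨ ((u ≡ᵇ j) ∧ (v ≡ᵇ i))

numTriangles : ℕ → List Edge → ℕ
numTriangles n es =
  length (concatMap (λ i → concatMap (λ j → concatMap (λ k →
    if (i <ᵇ j) ∧ (j <ᵇ k) ∧ joined es i j ∧ joined es i k ∧ joined es j k
    then (i , j , k) ∷ [] else [])
    [ n ]) [ n ]) [ n ])

expectedTriangles : ℕ → ℚ → ℚ
expectedTriangles n p = expectG n p (λ es → ℕtoℚ (numTriangles n es))

binPMF : ℕ → ℚ → ℕ → ℚ
binPMF m r k = ℕtoℚ (m C k) * ((r ^ℚ k) * ((1ℚ - r) ^ℚ (m ℕ.∸ k)))

binAtLeast1 : ℕ → ℚ → ℚ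
binAtLeast1 m r = sumℚ (map (binPMF m r) [ m ])

Mat : Set
Mat = Fin 4 → Fin 4 → ℚ

matMul : Mat → Mat → Mat
matMul A B i j = foldr (λ k acc → A i k * B k j + acc) 0ℚ
  (zero ∷ suc zero ∷ suc (suc zero) ∷ suc (suc (suc zero)) ∷ [])

idMat : Mat
idMat i j = if Data.Fin.toℕ i ≡ᵇ Data.Fin.toℕ j then 1ℚ else 0ℚ

matPow : Mat → ℕ → Mat
matPow A zero = idMat
matPow A (suc k) = matMul A (matPow A k)

transP : ℚ → Mat
transP p zero zero = 1ℚ - p * (+ 1 / 2)
transP p zero (suc zero) = p * (+ 1 / 2)
transP p (suc zero) (suc zero) = 1ℚ - p * (+ 1 / 3)
transP p (suc zero) (suc (suc zero)) = p * (+ 1 / 3)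
transP p (suc (suc zero)) (suc (suc zero)) = 1ℚ - p * (+ 1 / 6)
transP p (suc (suc zero)) (suc (suc (suc zero))) = p * (+ 1 / 6)
transP p (suc (suc (suc zero))) (suc (suc (suc zero))) = 1ℚ
transP p _ _ = 0ℚ

rhs : ℕ → ℚ → ℚ
rhs n p =
  ℕtoℚ (n C 3) *
    ((1ℚ - sumℚ (map q i012))
     + sumℚ (map (λ i → q i * (B ^ℚ (3 ℕ.∸ Data.Fin.toℕ i))) i012))
  where
  Pn : Mat
  Pn = matPow (transP p) (n ℕ.∸ 3)
  q : Fin 4 → ℚ
  q i = Pn zero i
  i012 : List (Fin 4)
  i012 = zero ∷ suc zero ∷ suc (suc zero) ∷ []
  B : ℚ
  B = binAtLeast1 ((n ℕ.∸ 3) C 2) (p * (+ 1 / 6))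

-- By linearity, the expected number of triangles is C(n,3) times the probability that a fixed triangle
-- T = {i,j,k} appears.  Inclusion–exclusion over the set S of pairs of T required to stay unjoined reduces
-- this to the probabilities that no 4-set adds a pair of S.  These 4-sets act independently, and a 4-set
-- containing c pairs of S avoids them with probability 1 − cp/6; the n − 3 4-sets containing T contain all
-- of S, and for each pair of S exactly C(n−3,2) 4-sets meet T in that pair alone.  On the other side,
-- P = I + (p/6)G, where the rate matrix G moves from state s to s + 1 at rate 3 − s; its eigenvectors
-- j ↦ C(3 − j, m), with eigenvalue 1 − mp/6 for P, turn the first row of P^(n−3) into the same alternating
-- sum, while ℙ(Bin(M, p/6) ≥ 1) = 1 − (1 − p/6)^M by the binomial theorem.

module Submission where

open import Defs
open import Data.Nat using (ℕ; _≥_; zero; suc)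
open import Data.Rational using (ℚ; 0ℚ; 1ℚ; _≤_)
open import Relation.Binary.PropositionalEquality using (_≡_)

open import Algebra.Bundles using (CommutativeMonoid; CommutativeRing)
open import Data.Bool using (Bool; true; false; T; not; _∧_; _∨_; if_then_else_)
open import Data.Bool.ListAction using (any; all)
open import Data.Bool.Properties
  using ( ∧-assoc; ∧-comm; ∧-identityʳ; ∧-zeroʳ; ∧-distribˡ-∨; ∨-identityʳ; ∨-comm; ∨-commutativeMonoid
        ; T-∧; T-∨)
open import Data.Empty using (⊥; ⊥-elim)
open import Data.Fin using (Fin; zero; suc; toℕ)
open import Data.Fin.Patterns using (0F; 1F; 2F; 3F)
open import Data.Fin.Properties using (all?)
import Data.Integer as ℤ
import Data.Integer.Properties as ℤ
open import Data.List using (List; []; _∷_; _++_; map; concatMap; filterᵇ; length; foldr; upTo; applyUpTo)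
open import Data.List.Properties
  using ( ++-identityʳ; ++-assoc; map-∘; map-cong; map-applyUpTo; concatMap-++; concatMap-map; concatMap-cong
        ; concatMap-pure; length-map; length-applyUpTo; length-++; filter-all; filter-reject)
open import Data.List.Relation.Binary.Sublist.Propositional using (_⊆_; []; _∷_; _∷ʳ_; minimum; ⊆-trans)
open import Data.List.Relation.Binary.Sublist.Propositional.Properties using (All-resp-⊆; length-mono-≤)
open import Data.List.Relation.Unary.All as All using (All; []; _∷_)
import Data.List.Relation.Unary.All.Properties as All
open import Data.List.Relation.Unary.AllPairs as AllPairs using (AllPairs; []; _∷_)
open import Data.List.Relation.Unary.AllPairs.Properties using (applyUpTo⁺₁)
open import Data.List.Relation.Unary.Unique.Propositional using (Unique)
import Data.Nat as ℕ
open import Data.Nat.Combinatorics using (_C_; nC1≡n; nCk+nC[k+1]≡[n+1]C[k+1])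
import Data.Nat.Coprimality as Coprime
open Coprime using (Coprime)
import Data.Nat.Properties as ℕ
open import Data.Product using (_×_; _,_; proj₁; proj₂)
open import Data.Rational using (_+_; _*_; _-_; -_; _/_; mkℚ)
open import Data.Rational.Properties
  using ( +-*-commutativeRing; _≟_; normalize-coprime; /-cong
        ; *-identityˡ; *-identityʳ; *-assoc; *-zeroˡ; +-identityˡ; *-distribʳ-+)
open import Data.Sum using (_⊎_; inj₁; inj₂)
open import Data.Unit using (tt)
open import Data.Vec using (Vec; []; _∷_; head; toList)
open import Function using (_∘_; id; Equivalence)
open import Level using (0ℓ)
open import Relation.Binary.PropositionalEquality
  using (_≢_; refl; sym; trans; cong; cong₂; subst; module ≡-Reasoning)
open import Relation.Nullary.Decidable using (T?; dec-true; dec-false; dec⇒maybe; toWitness)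
open import Tactic.RingSolver using (solve-∀)
import Tactic.RingSolver.Core.AlmostCommutativeRing as ACR

open CommutativeRing +-*-commutativeRing using (semiring; commutativeSemiring)
open import Algebra.Properties.CommutativeSemigroup (CommutativeMonoid.commutativeSemigroup ∨-commutativeMonoid)
  using () renaming (interchange to ∨-interchange)
open import Algebra.Properties.CommutativeSemiring.Binomial commutativeSemiring
  using (binomialTerm) renaming (theorem to binomial-theorem)
open import Algebra.Properties.Semiring.Exp semiring using (_^_)
open import Algebra.Properties.Semiring.Mult semiring using () renaming (_×_ to _×ℚ_)
open import Algebra.Properties.Semiring.Sum semiring
  using (sum-syntax; sum-cong-≗; sum-replicate-zero; ∑-comm; *-distribˡ-sum; *-distribʳ-sum)

private
  variable
    A B : Set

ℚ-ring : ACR.AlmostCommutativeRing 0ℓ 0ℓ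
ℚ-ring = ACR.fromCommutativeRing +-*-commutativeRing (λ x → dec⇒maybe (0ℚ ≟ x))

ℕtoℚ-+ : ∀ m n → ℕtoℚ (m ℕ.+ n) ≡ ℕtoℚ m + ℕtoℚ n
ℕtoℚ-+ m n = sym (begin
  ℕtoℚ m + ℕtoℚ n
    ≡⟨ cong₂ _+_ (normalize-coprime (coprime m)) (normalize-coprime (coprime n)) ⟩
  mkℚ (ℤ.+ m) 0 (coprime m) + mkℚ (ℤ.+ n) 0 (coprime n)
    ≡⟨ /-cong (cong₂ ℤ._+_ (ℤ.*-identityʳ (ℤ.+ m)) (ℤ.*-identityʳ (ℤ.+ n))) refl ⟩
  ℕtoℚ (m ℕ.+ n) ∎)
  where
  open ≡-Reasoning
  coprime : ∀ k → Coprime k 1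
  coprime k = Coprime.sym (Coprime.1-coprimeTo k)

1^ℚ : ∀ n → 1ℚ ^ℚ n ≡ 1ℚ
1^ℚ zero    = refl
1^ℚ (suc n) = cong (1ℚ *_) (1^ℚ n)

𝟙 : Bool → ℕ
𝟙 b = if b then 1 else 0

𝟙ℚ : Bool → ℚ
𝟙ℚ b = if b then 1ℚ else 0ℚ

⅙ : ℚ
⅙ = ℤ.+ 1 / 6

count : (A → Bool) → List A → ℕ
count P []       = 0
count P (x ∷ xs) = if P x then suc (count P xs) else count P xs

prodℚ : List ℚ → ℚ
prodℚ = foldr _*_ 1ℚ

count-++ : ∀ (P : A → Bool) xs ys → count P (xs ++ ys) ≡ count P xs ℕ.+ count P ys
count-++ P []       ys = refl
count-++ P (x ∷ xs) ys with P x
... | true  = cong suc (count-++ P xs ys)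
... | false = count-++ P xs ys

count-map : ∀ (P : B → Bool) (f : A → B) xs → count P (map f xs) ≡ count (P ∘ f) xs
count-map P f []       = refl
count-map P f (x ∷ xs) with P (f x)
... | true  = cong suc (count-map P f xs)
... | false = count-map P f xs

count-cong : ∀ {P Q : A → Bool} → (∀ x → P x ≡ Q x) → ∀ xs → count P xs ≡ count Q xs
count-cong P≗Q []       = refl
count-cong P≗Q (x ∷ xs) = cong₂ (λ b n → if b then suc n else n) (P≗Q x) (count-cong P≗Q xs)

count-none : ∀ {P : A → Bool} {xs} → All (λ x → P x ≡ false) xs → count P xs ≡ 0
count-none []                          = refl
count-none (¬Px ∷ ¬Pxs) rewrite ¬Px = count-none ¬Pxs

count-split : ∀ (P Q : A → Bool) xs →
  count P xs ≡ count (λ x → P x ∧ Q x) xs ℕ.+ count (λ x → P x ∧ not (Q x)) xs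
count-split P Q []       = refl
count-split P Q (x ∷ xs) with P x | Q x
... | true  | true  = cong suc (count-split P Q xs)
... | true  | false = trans (cong suc (count-split P Q xs)) (sym (ℕ.+-suc _ _))
... | false | _     = count-split P Q xs

count-∨ : ∀ {P Q : A → Bool} → (∀ x → T (P x) → T (Q x) → ⊥) →
  ∀ xs → count (λ x → P x ∨ Q x) xs ≡ count P xs ℕ.+ count Q xs
count-∨                 exclusive []       = refl
count-∨ {P = P} {Q = Q} exclusive (x ∷ xs) with P x in Px | Q x in Qx
... | true  | true  = ⊥-elim (exclusive x (subst T (sym Px) tt) (subst T (sym Qx) tt))
... | true  | false = cong suc (count-∨ exclusive xs)
... | false | true  = trans (cong suc (count-∨ exclusive xs)) (sym (ℕ.+-suc _ _))
... | false | false = count-∨ exclusive xs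

ℕtoℚ-count : ∀ (P : A → Bool) xs → ℕtoℚ (count P xs) ≡ sumℚ (map (𝟙ℚ ∘ P) xs)
ℕtoℚ-count P []       = refl
ℕtoℚ-count P (x ∷ xs) with P x
... | true  = trans (ℕtoℚ-+ 1 (count P xs)) (cong (1ℚ +_) (ℕtoℚ-count P xs))
... | false = trans (ℕtoℚ-count P xs) (sym (+-identityˡ _))

prodℚ-map-* : ∀ (f g : A → ℚ) xs →
  prodℚ (map (λ x → f x * g x) xs) ≡ prodℚ (map f xs) * prodℚ (map g xs)
prodℚ-map-* f g []       = refl
prodℚ-map-* f g (x ∷ xs) = trans (cong (f x * g x *_) (prodℚ-map-* f g xs)) (interchange (f x) (g x) _ _)
  where
  interchange : ∀ a b c d → (a * b) * (c * d) ≡ (a * c) * (b * d)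
  interchange = solve-∀ ℚ-ring

prodℚ-if-count : ∀ (P : A → Bool) c xs →
  prodℚ (map (λ x → if P x then c else 1ℚ) xs) ≡ c ^ℚ count P xs
prodℚ-if-count P c []       = refl
prodℚ-if-count P c (x ∷ xs) with P x
... | true  = cong (c *_) (prodℚ-if-count P c xs)
... | false = trans (*-identityˡ _) (prodℚ-if-count P c xs)

prodℚ-cong : ∀ {f g : A → ℚ} {xs} → All (λ x → f x ≡ g x) xs →
  prodℚ (map f xs) ≡ prodℚ (map g xs)
prodℚ-cong []            = refl
prodℚ-cong (fx≡gx ∷ eqs) = cong₂ _*_ fx≡gx (prodℚ-cong eqs)

sumℚ-map-const : ∀ {f : A → ℚ} {v xs} → All (λ x → f x ≡ v) xs →
  sumℚ (map f xs) ≡ ℕtoℚ (length xs) * v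
sumℚ-map-const {v = v} []                         = sym (*-zeroˡ v)
sumℚ-map-const {f = f} {v} {x ∷ xs} (fx≡v ∷ eqs) = begin
  f x + sumℚ (map f xs)          ≡⟨ cong₂ _+_ fx≡v (sumℚ-map-const eqs) ⟩
  v + ℕtoℚ (length xs) * v       ≡⟨ suc-* (ℕtoℚ (length xs)) v ⟩
  (1ℚ + ℕtoℚ (length xs)) * v    ≡⟨ cong (_* v) (sym (ℕtoℚ-+ 1 (length xs))) ⟩
  ℕtoℚ (suc (length xs)) * v     ∎
  where
  open ≡-Reasoning
  suc-* : ∀ n v → v + n * v ≡ (1ℚ + n) * v
  suc-* = solve-∀ ℚ-ring

sumℚ-linear : ∀ (f g : A → ℚ) α β xs →
  sumℚ (map (λ x → α * f x + β * g x) xs) ≡ α * sumℚ (map f xs) + β * sumℚ (map g xs)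
sumℚ-linear f g α β []       = sym (zero-combination α β)
  where
  zero-combination : ∀ α β → α * 0ℚ + β * 0ℚ ≡ 0ℚ
  zero-combination = solve-∀ ℚ-ring
sumℚ-linear f g α β (x ∷ xs) =
  trans (cong (α * f x + β * g x +_) (sumℚ-linear f g α β xs)) (regroup α β (f x) (g x) _ _)
  where
  regroup : ∀ α β a b F G → (α * a + β * b) + (α * F + β * G) ≡ α * (a + F) + β * (b + G)
  regroup = solve-∀ ℚ-ring

sumℚ-*ʳ : ∀ (f : A → ℚ) c xs → sumℚ (map (λ x → f x * c) xs) ≡ sumℚ (map f xs) * c
sumℚ-*ʳ f c []       = sym (*-zeroˡ c)
sumℚ-*ʳ f c (x ∷ xs) = trans (cong (f x * c +_) (sumℚ-*ʳ f c xs)) (sym (*-distribʳ-+ c (f x) _))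

any-∨ : ∀ (P Q : A → Bool) xs → any (λ x → P x ∨ Q x) xs ≡ any P xs ∨ any Q xs
any-∨ P Q []       = refl
any-∨ P Q (x ∷ xs) =
  trans (cong ((P x ∨ Q x) ∨_) (any-∨ P Q xs)) (∨-interchange (P x) (Q x) (any P xs) (any Q xs))

any-∧ : ∀ b (P : A → Bool) xs → any (λ x → b ∧ P x) xs ≡ b ∧ any P xs
any-∧ b P []       = sym (∧-zeroʳ b)
any-∧ b P (x ∷ xs) =
  trans (cong ((b ∧ P x) ∨_) (any-∧ b P xs)) (sym (∧-distribˡ-∨ b (P x) (any P xs)))

prodℚ-patterns : ∀ (φ : Bool → Bool → Bool → ℚ) →
  φ false false false ≡ 1ℚ →
  φ true false false ≡ 1ℚ → φ false true false ≡ 1ℚ → φ false false true ≡ 1ℚ →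
  ∀ (α β γ : A → Bool) xs →
  prodℚ (map (λ x → φ (α x) (β x) (γ x)) xs)
    ≡ φ true true true ^ℚ count (λ x → α x ∧ β x ∧ γ x) xs
      * (φ true true false ^ℚ count (λ x → (α x ∧ β x) ∧ not (γ x)) xs
      * (φ true false true ^ℚ count (λ x → (α x ∧ γ x) ∧ not (β x)) xs
      * φ false true true ^ℚ count (λ x → (β x ∧ γ x) ∧ not (α x)) xs))
prodℚ-patterns {A = A} φ φ₀ φ₁ φ₂ φ₃ α β γ xs = begin
  prodℚ (map (λ x → φ (α x) (β x) (γ x)) xs)
    ≡⟨ prodℚ-cong (All.universal (λ x → by-pattern (α x) (β x) (γ x)) xs) ⟩
  prodℚ (map (λ x → g₁ x * (g₂ x * (g₃ x * g₄ x))) xs)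
    ≡⟨ prodℚ-map-* g₁ _ xs ⟩
  prodℚ (map g₁ xs) * prodℚ (map (λ x → g₂ x * (g₃ x * g₄ x)) xs)
    ≡⟨ cong (prodℚ (map g₁ xs) *_)
            (trans (prodℚ-map-* g₂ _ xs) (cong (prodℚ (map g₂ xs) *_) (prodℚ-map-* g₃ g₄ xs))) ⟩
  prodℚ (map g₁ xs) * (prodℚ (map g₂ xs) * (prodℚ (map g₃ xs) * prodℚ (map g₄ xs)))
    ≡⟨ cong₂ _*_ (prodℚ-if-count _ _ xs)
         (cong₂ _*_ (prodℚ-if-count _ _ xs) (cong₂ _*_ (prodℚ-if-count _ _ xs) (prodℚ-if-count _ _ xs))) ⟩
  φ true true true ^ℚ count (λ x → α x ∧ β x ∧ γ x) xs
    * (φ true true false ^ℚ count (λ x → (α x ∧ β x) ∧ not (γ x)) xs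
    * (φ true false true ^ℚ count (λ x → (α x ∧ γ x) ∧ not (β x)) xs
    * φ false true true ^ℚ count (λ x → (β x ∧ γ x) ∧ not (α x)) xs)) ∎
  where
  open ≡-Reasoning
  g₁ g₂ g₃ g₄ : A → ℚ
  g₁ x = if α x ∧ β x ∧ γ x then φ true true true else 1ℚ
  g₂ x = if (α x ∧ β x) ∧ not (γ x) then φ true true false else 1ℚ
  g₃ x = if (α x ∧ γ x) ∧ not (β x) then φ true false true else 1ℚ
  g₄ x = if (β x ∧ γ x) ∧ not (α x) then φ false true true else 1ℚ
  padded₁ : ∀ x → x ≡ x * (1ℚ * (1ℚ * 1ℚ))
  padded₁ = solve-∀ ℚ-ring
  padded₂ : ∀ x → x ≡ 1ℚ * (x * (1ℚ * 1ℚ))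
  padded₂ = solve-∀ ℚ-ring
  padded₃ : ∀ x → x ≡ 1ℚ * (1ℚ * (x * 1ℚ))
  padded₃ = solve-∀ ℚ-ring
  padded₄ : ∀ x → x ≡ 1ℚ * (1ℚ * (1ℚ * x))
  padded₄ = solve-∀ ℚ-ring
  by-pattern : ∀ a b c → φ a b c ≡ (if a ∧ b ∧ c then φ true true true else 1ℚ)
    * ((if (a ∧ b) ∧ not c then φ true true false else 1ℚ)
    * ((if (a ∧ c) ∧ not b then φ true false true else 1ℚ)
    * (if (b ∧ c) ∧ not a then φ false true true else 1ℚ)))
  by-pattern true  true  true  = padded₁ _
  by-pattern true  true  false = padded₂ _
  by-pattern true  false true  = padded₃ _
  by-pattern false true  true  = padded₄ _
  by-pattern true  false false = φ₁
  by-pattern false true  false = φ₂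
  by-pattern false false true  = φ₃
  by-pattern false false false = φ₀

Sorted : List ℕ → Set
Sorted = AllPairs ℕ._<_

Sorted-resp-⊆ : ∀ {xs ys} → xs ⊆ ys → Sorted ys → Sorted xs
Sorted-resp-⊆ []             []              = []
Sorted-resp-⊆ (y ∷ʳ xs⊆ys)   (_ ∷ sorted)    = Sorted-resp-⊆ xs⊆ys sorted
Sorted-resp-⊆ (refl ∷ xs⊆ys) (y<ys ∷ sorted) = All-resp-⊆ xs⊆ys y<ys ∷ Sorted-resp-⊆ xs⊆ys sorted

Sorted-[n] : ∀ n → Sorted [ n ]
Sorted-[n] n = subst Sorted (sym (map-applyUpTo id suc n)) (applyUpTo⁺₁ suc n (λ i<j _ → ℕ.s<s i<j))

length-[n] : ∀ n → length [ n ] ≡ n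
length-[n] n = trans (length-map suc (upTo n)) (length-applyUpTo id n)

Sorted⇒Unique : ∀ {xs} → Sorted xs → Unique xs
Sorted⇒Unique = AllPairs.map ℕ.<⇒≢

combinations : (k : ℕ) → List A → List (Vec A k)
combinations zero    xs       = [] ∷ []
combinations (suc k) []       = []
combinations (suc k) (x ∷ xs) = map (x ∷_) (combinations k xs) ++ combinations (suc k) xs

length-combinations : ∀ k (xs : List A) → length (combinations k xs) ≡ length xs C k
length-combinations zero    xs       = refl
length-combinations (suc k) []       = refl
length-combinations (suc k) (x ∷ xs) = begin
  length (map (x ∷_) (combinations k xs) ++ combinations (suc k) xs)
    ≡⟨ length-++ (map (x ∷_) (combinations k xs)) ⟩
  length (map (x ∷_) (combinations k xs)) ℕ.+ length (combinations (suc k) xs)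
    ≡⟨ cong₂ ℕ._+_ (trans (length-map (x ∷_) (combinations k xs)) (length-combinations k xs))
                   (length-combinations (suc k) xs) ⟩
  length xs C k ℕ.+ length xs C suc k
    ≡⟨ nCk+nC[k+1]≡[n+1]C[k+1] (length xs) k ⟩
  suc (length xs) C suc k ∎
  where open ≡-Reasoning

combinations-⊆ : ∀ k (xs : List A) → All (λ v → toList v ⊆ xs) (combinations k xs)
combinations-⊆ zero    xs       = minimum xs ∷ []
combinations-⊆ (suc k) []       = []
combinations-⊆ (suc k) (x ∷ xs) =
  All.++⁺ (All.map⁺ (All.map (refl ∷_) (combinations-⊆ k xs)))
          (All.map (x ∷ʳ_) (combinations-⊆ (suc k) xs))

when : Bool → List A → List A
when b xs = if b then xs else []

when-∧ : ∀ a b (xs : List A) → when (a ∧ b) xs ≡ when a (when b xs)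
when-∧ true  b xs = refl
when-∧ false b xs = refl

concatMap-empty : ∀ (xs : List A) → concatMap (λ _ → []) xs ≡ ([] {A = B})
concatMap-empty []       = refl
concatMap-empty (x ∷ xs) = concatMap-empty xs

concatMap-when : ∀ (P : A → Bool) (F : A → List B) xs →
  concatMap (λ x → when (P x) (F x)) xs ≡ concatMap F (filterᵇ P xs)
concatMap-when P F []       = refl
concatMap-when P F (x ∷ xs) with P x
... | true  = cong (F x ++_) (concatMap-when P F xs)
... | false = concatMap-when P F xs

length-concatMap-when : ∀ (P : A → Bool) (f : A → B) xs →
  length (concatMap (λ x → when (P x) (f x ∷ [])) xs) ≡ count P xs
length-concatMap-when P f []       = refl
length-concatMap-when P f (x ∷ xs) with P x
... | true  = cong suc (length-concatMap-when P f xs)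
... | false = length-concatMap-when P f xs

above : ℕ → List ℕ → List ℕ
above a = filterᵇ (a ℕ.<ᵇ_)

above-suffix : ∀ P x X → Sorted (P ++ x ∷ X) → above x (P ++ x ∷ X) ≡ X
above-suffix []      x X (x<X ∷ _) =
  trans (filter-reject (T? ∘ (x ℕ.<ᵇ_)) {x = x} {xs = X} (ℕ.<-irrefl refl ∘ ℕ.<ᵇ⇒< x x))
        (filter-all (T? ∘ (x ℕ.<ᵇ_)) (All.map ℕ.<⇒<ᵇ x<X))
above-suffix (y ∷ P) x X (y<rest ∷ sorted) with All.++⁻ʳ P y<rest
... | y<x ∷ _ =
  trans (filter-reject (T? ∘ (x ℕ.<ᵇ_)) {x = y} {xs = P ++ x ∷ X}
                       (λ x<ᵇy → ℕ.<-asym y<x (ℕ.<ᵇ⇒< x y x<ᵇy)))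
        (above-suffix P x X sorted)

whenIncreasing : ∀ {k} → Vec ℕ k → List A → List A
whenIncreasing (a ∷ b ∷ v) xs = when (a ℕ.<ᵇ b) (whenIncreasing (b ∷ v) xs)
whenIncreasing _           xs = xs

module Enumeration {B : Set} (Z : List ℕ) where

  tuples : (k : ℕ) → List ℕ → (Vec ℕ k → List B) → List B
  tuples zero    X F = F []
  tuples (suc k) X F = concatMap (λ x → tuples k Z (λ v → F (x ∷ v))) X

  increasingTuples : (k : ℕ) → List ℕ → (Vec ℕ k → List B) → List B
  increasingTuples zero    X F = F []
  increasingTuples (suc k) X F = concatMap (λ x → increasingTuples k (above x Z) (λ v → F (x ∷ v))) X

  tuples-cong : ∀ k X {F G : Vec ℕ k → List B} → (∀ v → F v ≡ G v) → tuples k X F ≡ tuples k X G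
  tuples-cong zero    X F≗G = F≗G []
  tuples-cong (suc k) X F≗G = concatMap-cong (λ x → tuples-cong k Z (λ v → F≗G (x ∷ v))) X

  tuples-empty : ∀ k X → tuples k X (λ _ → []) ≡ []
  tuples-empty zero    X = refl
  tuples-empty (suc k) X = trans (concatMap-cong (λ _ → tuples-empty k Z) X) (concatMap-empty X)

  tuples-when : ∀ k X b (F : Vec ℕ k → List B) →
    tuples k X (λ v → when b (F v)) ≡ when b (tuples k X F)
  tuples-when k X true  F = refl
  tuples-when k X false F = tuples-empty k X

  tuples-above : ∀ k a X (F : Vec ℕ (suc k) → List B) →
    tuples (suc k) X (λ v → when (a ℕ.<ᵇ head v) (F v)) ≡ tuples (suc k) (above a X) F
  tuples-above k a X F =
    trans (concatMap-cong (λ x → tuples-when k Z (a ℕ.<ᵇ x) (λ v → F (x ∷ v))) X)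
          (concatMap-when (a ℕ.<ᵇ_) (λ x → tuples k Z (λ v → F (x ∷ v))) X)

  tuples-increasing : ∀ k X (F : Vec ℕ k → List B) →
    tuples k X (λ v → whenIncreasing v (F v)) ≡ increasingTuples k X F
  tuples-increasing zero    X F = refl
  tuples-increasing (suc k) X F = concatMap-cong (λ x → after x k (λ v → F (x ∷ v))) X
    where
    after : ∀ x k (G : Vec ℕ k → List B) →
      tuples k Z (λ v → whenIncreasing (x ∷ v) (G v)) ≡ increasingTuples k (above x Z) G
    after x zero    G = refl
    after x (suc k) G = begin
      tuples (suc k) Z (λ v → whenIncreasing (x ∷ v) (G v))
        ≡⟨ tuples-cong (suc k) Z {F = λ v → whenIncreasing (x ∷ v) (G v)}
                                 {G = λ v → when (x ℕ.<ᵇ head v) (whenIncreasing v (G v))}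
                                 (λ { (y ∷ v) → refl }) ⟩
      tuples (suc k) Z (λ v → when (x ℕ.<ᵇ head v) (whenIncreasing v (G v)))
        ≡⟨ tuples-above k x Z (λ v → whenIncreasing v (G v)) ⟩
      tuples (suc k) (above x Z) (λ v → whenIncreasing v (G v))
        ≡⟨ tuples-increasing (suc k) (above x Z) G ⟩
      increasingTuples (suc k) (above x Z) G ∎
      where open ≡-Reasoning

  increasingTuples-combinations : Sorted Z → ∀ k P X (F : Vec ℕ k → List B) → P ++ X ≡ Z →
    increasingTuples k X F ≡ concatMap F (combinations k X)
  increasingTuples-combinations sorted zero    P X       F eq = sym (++-identityʳ (F []))
  increasingTuples-combinations sorted (suc k) P []      F eq = refl
  increasingTuples-combinations sorted (suc k) P (x ∷ X) F eq = begin
    increasingTuples k (above x Z) (λ v → F (x ∷ v)) ++ increasingTuples (suc k) X F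
      ≡⟨ cong (λ Y → increasingTuples k Y (λ v → F (x ∷ v)) ++ increasingTuples (suc k) X F) above-x ⟩
    increasingTuples k X (λ v → F (x ∷ v)) ++ increasingTuples (suc k) X F
      ≡⟨ cong₂ _++_ (increasingTuples-combinations sorted k (P ++ x ∷ []) X (λ v → F (x ∷ v)) eq′)
                    (increasingTuples-combinations sorted (suc k) (P ++ x ∷ []) X F eq′) ⟩
    concatMap (λ v → F (x ∷ v)) (combinations k X) ++ concatMap F (combinations (suc k) X)
      ≡⟨ cong (_++ concatMap F (combinations (suc k) X)) (concatMap-map F (x ∷_) (combinations k X)) ⟨
    concatMap F (map (x ∷_) (combinations k X)) ++ concatMap F (combinations (suc k) X)
      ≡⟨ concatMap-++ F (map (x ∷_) (combinations k X)) (combinations (suc k) X) ⟨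
    concatMap F (combinations (suc k) (x ∷ X)) ∎
    where
    open ≡-Reasoning
    above-x : above x Z ≡ X
    above-x = trans (cong (above x) (sym eq)) (above-suffix P x X (subst Sorted (sym eq) sorted))
    eq′ : (P ++ x ∷ []) ++ X ≡ Z
    eq′ = trans (++-assoc P (x ∷ []) X) eq

  tuples-combinations : Sorted Z → ∀ k (F : Vec ℕ k → List B) →
    tuples k Z (λ v → whenIncreasing v (F v)) ≡ concatMap F (combinations k Z)
  tuples-combinations sorted k F =
    trans (tuples-increasing k Z F) (increasingTuples-combinations sorted k [] Z F refl)

open Enumeration using (tuples; tuples-cong; tuples-combinations)

toQuad : Vec ℕ 4 → Quad
toQuad (a ∷ b ∷ c ∷ d ∷ []) = (a , b , c , d)

-- quads n and numTriangles n es unfold to tuples [ n ] k [ n ] applied to these loop bodies.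
quadLoopBody : Vec ℕ 4 → List Quad
quadLoopBody (a ∷ b ∷ c ∷ d ∷ []) =
  if (a ℕ.<ᵇ b) ∧ (b ℕ.<ᵇ c) ∧ (c ℕ.<ᵇ d) then (a , b , c , d) ∷ [] else []

quads-combinations : ∀ n → quads n ≡ map toQuad (combinations 4 [ n ])
quads-combinations n = begin
  tuples [ n ] 4 [ n ] quadLoopBody
    ≡⟨ tuples-cong [ n ] 4 [ n ] increasing ⟩
  tuples [ n ] 4 [ n ] (λ v → whenIncreasing v (toQuad v ∷ []))
    ≡⟨ tuples-combinations [ n ] (Sorted-[n] n) 4 (λ v → toQuad v ∷ []) ⟩
  concatMap (λ v → toQuad v ∷ []) (combinations 4 [ n ])
    ≡⟨ concatMap-map (_∷ []) toQuad (combinations 4 [ n ]) ⟨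
  concatMap (_∷ []) (map toQuad (combinations 4 [ n ]))
    ≡⟨ concatMap-pure (map toQuad (combinations 4 [ n ])) ⟩
  map toQuad (combinations 4 [ n ]) ∎
  where
  open ≡-Reasoning
  increasing : ∀ v → quadLoopBody v ≡ whenIncreasing v (toQuad v ∷ [])
  increasing (a ∷ b ∷ c ∷ d ∷ []) =
    trans (when-∧ (a ℕ.<ᵇ b) _ _) (cong (when (a ℕ.<ᵇ b)) (when-∧ (b ℕ.<ᵇ c) _ _))

isTriangle : List Edge → Vec ℕ 3 → Bool
isTriangle es (i ∷ j ∷ k ∷ []) = joined es i j ∧ joined es i k ∧ joined es j k

triangleLoopBody : List Edge → Vec ℕ 3 → List (ℕ × ℕ × ℕ)
triangleLoopBody es (i ∷ j ∷ k ∷ []) =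
  if (i ℕ.<ᵇ j) ∧ (j ℕ.<ᵇ k) ∧ joined es i j ∧ joined es i k ∧ joined es j k
  then (i , j , k) ∷ [] else []

toTriple : Vec ℕ 3 → ℕ × ℕ × ℕ
toTriple (i ∷ j ∷ k ∷ []) = (i , j , k)

numTriangles-count : ∀ n es → numTriangles n es ≡ count (isTriangle es) (combinations 3 [ n ])
numTriangles-count n es = begin
  length (tuples [ n ] 3 [ n ] (triangleLoopBody es))
    ≡⟨ cong length (tuples-cong [ n ] 3 [ n ] increasing) ⟩
  length (tuples [ n ] 3 [ n ] (λ v → whenIncreasing v (when (isTriangle es v) (toTriple v ∷ []))))
    ≡⟨ cong length (tuples-combinations [ n ] (Sorted-[n] n) 3 _) ⟩
  length (concatMap (λ v → when (isTriangle es v) (toTriple v ∷ [])) (combinations 3 [ n ]))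
    ≡⟨ length-concatMap-when (isTriangle es) toTriple (combinations 3 [ n ]) ⟩
  count (isTriangle es) (combinations 3 [ n ]) ∎
  where
  open ≡-Reasoning
  increasing : ∀ v → triangleLoopBody es v ≡ whenIncreasing v (when (isTriangle es v) (toTriple v ∷ []))
  increasing (i ∷ j ∷ k ∷ []) =
    trans (when-∧ (i ℕ.<ᵇ j) _ _) (cong (when (i ℕ.<ᵇ j)) (when-∧ (j ℕ.<ᵇ k) _ _))

_∈ᵇ_ : ℕ → List ℕ → Bool
x ∈ᵇ L = any (ℕ._≡ᵇ x) L

containsAll : List ℕ → List ℕ → Bool
containsAll Y L = all (_∈ᵇ L) Y

≡ᵇ-refl : ∀ m → (m ℕ.≡ᵇ m) ≡ true
≡ᵇ-refl m = dec-true (m ℕ.≟ m) refl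

≢⇒≡ᵇ-false : ∀ {m n} → m ≢ n → (m ℕ.≡ᵇ n) ≡ false
≢⇒≡ᵇ-false {m} {n} = dec-false (m ℕ.≟ n)

≡ᵇ⇒≡ : ∀ m n → (m ℕ.≡ᵇ n) ≡ true → m ≡ n
≡ᵇ⇒≡ m n m≡ᵇn = ℕ.≡ᵇ⇒≡ m n (subst T (sym m≡ᵇn) tt)

∈ᵇ-false : ∀ {x L} → All (_≢ x) L → x ∈ᵇ L ≡ false
∈ᵇ-false []                                   = refl
∈ᵇ-false (y≢x ∷ L≢x) rewrite ≢⇒≡ᵇ-false y≢x = ∈ᵇ-false L≢x

containsAll-∷ : ∀ {x Y} L → All (x ≢_) Y → containsAll Y (x ∷ L) ≡ containsAll Y L
containsAll-∷ L []                                 = refl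
containsAll-∷ L (x≢y ∷ x≢Y) rewrite ≢⇒≡ᵇ-false x≢y = cong (_ ∧_) (containsAll-∷ L x≢Y)

-- C(d, r − y), read as 0 when r < y
supersetCount : ℕ → ℕ → ℕ → ℕ
supersetCount d zero    r       = d C r
supersetCount d (suc y) zero    = 0
supersetCount d (suc y) (suc r) = supersetCount d y r

supersetCount-pascal : ∀ d y r →
  supersetCount (suc d) y (suc r) ≡ supersetCount d y r ℕ.+ supersetCount d y (suc r)
supersetCount-pascal d zero          r       = sym (nCk+nC[k+1]≡[n+1]C[k+1] d r)
supersetCount-pascal d (suc zero)    zero    = refl
supersetCount-pascal d (suc (suc y)) zero    = refl
supersetCount-pascal d (suc y)       (suc r) = supersetCount-pascal d y r

supersetCount-+ : ∀ d y r → supersetCount d y (y ℕ.+ r) ≡ d C r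
supersetCount-+ d zero    r = refl
supersetCount-+ d (suc y) r = supersetCount-+ d y r

count-supersets : ∀ {Y X} → Y ⊆ X → Sorted X → ∀ r →
  count (containsAll Y ∘ toList) (combinations r X) ≡ supersetCount (length X ℕ.∸ length Y) (length Y) r
count-supersets []                 []               zero    = refl
count-supersets []                 []               (suc r) = refl
count-supersets {[]}    (x ∷ʳ Y⊆X) sorted           zero    = refl
count-supersets {y ∷ Y} (x ∷ʳ Y⊆X) sorted           zero    = refl
count-supersets {Y} {x ∷ X} (x ∷ʳ Y⊆X) (x<X ∷ sorted) (suc r) = begin
  count (containsAll Y ∘ toList) (map (x ∷_) (combinations r X) ++ combinations (suc r) X)
    ≡⟨ count-++ _ (map (x ∷_) (combinations r X)) (combinations (suc r) X) ⟩
  count (containsAll Y ∘ toList) (map (x ∷_) (combinations r X))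
    ℕ.+ count (containsAll Y ∘ toList) (combinations (suc r) X)
    ≡⟨ cong (ℕ._+ _) (trans (count-map _ (x ∷_) (combinations r X))
                            (count-cong (λ v → containsAll-∷ (toList v) x∉Y) (combinations r X))) ⟩
  count (containsAll Y ∘ toList) (combinations r X)
    ℕ.+ count (containsAll Y ∘ toList) (combinations (suc r) X)
    ≡⟨ cong₂ ℕ._+_ (count-supersets Y⊆X sorted r) (count-supersets Y⊆X sorted (suc r)) ⟩
  supersetCount d (length Y) r ℕ.+ supersetCount d (length Y) (suc r)
    ≡⟨ supersetCount-pascal d (length Y) r ⟨
  supersetCount (suc d) (length Y) (suc r)
    ≡⟨ cong (λ e → supersetCount e (length Y) (suc r)) (ℕ.+-∸-assoc 1 (length-mono-≤ Y⊆X)) ⟨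
  supersetCount (suc (length X) ℕ.∸ length Y) (length Y) (suc r) ∎
  where
  open ≡-Reasoning
  d : ℕ
  d = length X ℕ.∸ length Y
  x∉Y : All (x ≢_) Y
  x∉Y = All.map ℕ.<⇒≢ (All-resp-⊆ Y⊆X x<X)
count-supersets (refl ∷ Y⊆X) sorted zero = refl
count-supersets {x ∷ Y} {x ∷ X} (refl ∷ Y⊆X) (x<X ∷ sorted) (suc r) = begin
  count (containsAll (x ∷ Y) ∘ toList) (map (x ∷_) (combinations r X) ++ combinations (suc r) X)
    ≡⟨ count-++ _ (map (x ∷_) (combinations r X)) (combinations (suc r) X) ⟩
  count (containsAll (x ∷ Y) ∘ toList) (map (x ∷_) (combinations r X))
    ℕ.+ count (containsAll (x ∷ Y) ∘ toList) (combinations (suc r) X)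
    ≡⟨ cong₂ ℕ._+_ (trans (count-map _ (x ∷_) (combinations r X)) (count-cong with-x (combinations r X)))
                   (count-none without-x) ⟩
  count (containsAll Y ∘ toList) (combinations r X) ℕ.+ 0
    ≡⟨ ℕ.+-identityʳ _ ⟩
  count (containsAll Y ∘ toList) (combinations r X)
    ≡⟨ count-supersets Y⊆X sorted r ⟩
  supersetCount (length X ℕ.∸ length Y) (length Y) r ∎
  where
  open ≡-Reasoning
  x∉Y : All (x ≢_) Y
  x∉Y = All.map ℕ.<⇒≢ (All-resp-⊆ Y⊆X x<X)
  with-x : ∀ v → containsAll (x ∷ Y) (x ∷ toList v) ≡ containsAll Y (toList v)
  with-x v rewrite ≡ᵇ-refl x = containsAll-∷ (toList v) x∉Y
  without-x : All (λ v → containsAll (x ∷ Y) (toList v) ≡ false) (combinations (suc r) X)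
  without-x = All.map (λ v⊆X → cong (_∧ _) (∈ᵇ-false (All.map ℕ.>⇒≢ (All-resp-⊆ v⊆X x<X))))
                      (combinations-⊆ (suc r) X)

count-supersets-exact : ∀ {Y X} → Y ⊆ X → Sorted X → ∀ r →
  count (containsAll Y ∘ toList) (combinations (length Y ℕ.+ r) X) ≡ (length X ℕ.∸ length Y) C r
count-supersets-exact {Y} {X} Y⊆X sorted r =
  trans (count-supersets Y⊆X sorted (length Y ℕ.+ r)) (supersetCount-+ (length X ℕ.∸ length Y) (length Y) r)

count-containing-triple : ∀ {Z i j k} → Sorted Z → i ∷ j ∷ k ∷ [] ⊆ Z →
  count (λ v → i ∈ᵇ toList v ∧ j ∈ᵇ toList v ∧ k ∈ᵇ toList v) (combinations 4 Z)
    ≡ length Z ℕ.∸ 3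
count-containing-triple {Z} {i} {j} {k} sorted ijk⊆Z = begin
  count (λ v → i ∈ᵇ toList v ∧ j ∈ᵇ toList v ∧ k ∈ᵇ toList v) (combinations 4 Z)
    ≡⟨ count-cong (λ v → cong (λ b → i ∈ᵇ toList v ∧ j ∈ᵇ toList v ∧ b)
                              (∧-identityʳ (k ∈ᵇ toList v)))
                  (combinations 4 Z) ⟨
  count (containsAll (i ∷ j ∷ k ∷ []) ∘ toList) (combinations (3 ℕ.+ 1) Z)
    ≡⟨ count-supersets-exact ijk⊆Z sorted 1 ⟩
  (length Z ℕ.∸ 3) C 1
    ≡⟨ nC1≡n _ ⟩
  length Z ℕ.∸ 3 ∎
  where open ≡-Reasoning

count-containing-exactly-pair : ∀ {Z x y} z → Sorted Z → x ∷ y ∷ [] ⊆ Z → 3 ℕ.≤ length Z →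
  count (λ v → (x ∈ᵇ toList v ∧ y ∈ᵇ toList v) ∧ z ∈ᵇ toList v) (combinations 4 Z)
    ≡ length Z ℕ.∸ 3 →
  count (λ v → (x ∈ᵇ toList v ∧ y ∈ᵇ toList v) ∧ not (z ∈ᵇ toList v)) (combinations 4 Z)
    ≡ (length Z ℕ.∸ 3) C 2
count-containing-exactly-pair {Z} {x} {y} z sorted xy⊆Z 3≤∣Z∣ with-z = ℕ.+-cancelˡ-≡ N _ _ (begin
  N ℕ.+ count (λ v → pair v ∧ not (z ∈ᵇ toList v)) Ls
    ≡⟨ cong (ℕ._+ count (λ v → pair v ∧ not (z ∈ᵇ toList v)) Ls) with-z ⟨
  count (λ v → pair v ∧ z ∈ᵇ toList v) Ls ℕ.+ count (λ v → pair v ∧ not (z ∈ᵇ toList v)) Ls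
    ≡⟨ count-split pair (λ v → z ∈ᵇ toList v) Ls ⟨
  count pair Ls
    ≡⟨ count-cong (λ v → cong (x ∈ᵇ toList v ∧_) (sym (∧-identityʳ (y ∈ᵇ toList v)))) Ls ⟩
  count (containsAll (x ∷ y ∷ []) ∘ toList) (combinations (2 ℕ.+ 2) Z)
    ≡⟨ count-supersets-exact xy⊆Z sorted 2 ⟩
  (length Z ℕ.∸ 2) C 2
    ≡⟨ cong (λ m → (m ℕ.∸ 2) C 2) (ℕ.m+[n∸m]≡n 3≤∣Z∣) ⟨
  suc N C 2
    ≡⟨ nCk+nC[k+1]≡[n+1]C[k+1] N 1 ⟨
  N C 1 ℕ.+ N C 2
    ≡⟨ cong (ℕ._+ N C 2) (nC1≡n N) ⟩
  N ℕ.+ N C 2 ∎)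
  where
  open ≡-Reasoning
  N : ℕ
  N = length Z ℕ.∸ 3
  Ls : List (Vec ℕ 4)
  Ls = combinations 4 Z
  pair : Vec ℕ 4 → Bool
  pair v = x ∈ᵇ toList v ∧ y ∈ᵇ toList v

-- Expectation over the random choices of the 4-sets

expectOver-cong : ∀ p Hs {f g : List Edge → ℚ} → (∀ es → f es ≡ g es) →
  expectOver p Hs f ≡ expectOver p Hs g
expectOver-cong p []       f≗g = f≗g []
expectOver-cong p (H ∷ Hs) f≗g = cong sumℚ (map-cong (λ k →
  cong₂ (λ a b → ⅙ * (p * a) + ⅙ * ((1ℚ - p) * b))
        (expectOver-cong p Hs (λ es → f≗g (pairOf H k ∷ es))) (expectOver-cong p Hs f≗g)) allFin6)

expectOver-linear : ∀ p Hs α β (f g : List Edge → ℚ) →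
  expectOver p Hs (λ es → α * f es + β * g es) ≡ α * expectOver p Hs f + β * expectOver p Hs g
expectOver-linear p []       α β f g = refl
expectOver-linear p (H ∷ Hs) α β f g = trans
  (cong sumℚ (map-cong (λ k → trans
    (cong₂ (λ a b → ⅙ * (p * a) + ⅙ * ((1ℚ - p) * b))
           (expectOver-linear p Hs α β (λ es → f (pairOf H k ∷ es)) (λ es → g (pairOf H k ∷ es)))
           (expectOver-linear p Hs α β f g))
    (regroup ⅙ p α β _ _ _ _)) allFin6))
  (sumℚ-linear (step f) (step g) α β allFin6)
  where
  step : (List Edge → ℚ) → Fin 6 → ℚ
  step h k = ⅙ * (p * expectOver p Hs (λ es → h (pairOf H k ∷ es))) + ⅙ * ((1ℚ - p) * expectOver p Hs h)
  regroup : ∀ c p α β a b A B →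
    c * (p * (α * a + β * b)) + c * ((1ℚ - p) * (α * A + β * B))
      ≡ α * (c * (p * a) + c * ((1ℚ - p) * A)) + β * (c * (p * b) + c * ((1ℚ - p) * B))
  regroup = solve-∀ ℚ-ring

expectOver-scale : ∀ p Hs α (f : List Edge → ℚ) →
  expectOver p Hs (λ es → α * f es) ≡ α * expectOver p Hs f
expectOver-scale p Hs α f = begin
  expectOver p Hs (λ es → α * f es)                   ≡⟨ expectOver-cong p Hs (λ es → pad α (f es)) ⟩
  expectOver p Hs (λ es → α * f es + 0ℚ * f es)       ≡⟨ expectOver-linear p Hs α 0ℚ f f ⟩
  α * expectOver p Hs f + 0ℚ * expectOver p Hs f      ≡⟨ pad α (expectOver p Hs f) ⟨
  α * expectOver p Hs f                               ∎
  where
  open ≡-Reasoning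
  pad : ∀ α x → α * x ≡ α * x + 0ℚ * x
  pad = solve-∀ ℚ-ring

expectOver-const : ∀ p Hs v → expectOver p Hs (λ _ → v) ≡ v
expectOver-const p []       v = refl
expectOver-const p (H ∷ Hs) v = trans
  (sumℚ-map-const (All.universal (λ k → cong₂ (λ a b → ⅙ * (p * a) + ⅙ * ((1ℚ - p) * b))
                                              (expectOver-const p Hs v) (expectOver-const p Hs v)) allFin6))
  (six-sixths p v)
  where
  six-sixths : ∀ p v → ℕtoℚ 6 * (⅙ * (p * v) + ⅙ * ((1ℚ - p) * v)) ≡ v
  six-sixths = solve-∀ ℚ-ring

expectOver-sum : ∀ p Hs (F : A → List Edge → ℚ) ts →
  expectOver p Hs (λ es → sumℚ (map (λ t → F t es) ts)) ≡ sumℚ (map (λ t → expectOver p Hs (F t)) ts)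
expectOver-sum p Hs F []       = expectOver-const p Hs 0ℚ
expectOver-sum p Hs F (t ∷ ts) = begin
  expectOver p Hs (λ es → F t es + S es)
    ≡⟨ expectOver-cong p Hs (λ es → unit (F t es) (S es)) ⟩
  expectOver p Hs (λ es → 1ℚ * F t es + 1ℚ * S es)
    ≡⟨ expectOver-linear p Hs 1ℚ 1ℚ (F t) S ⟩
  1ℚ * expectOver p Hs (F t) + 1ℚ * expectOver p Hs S
    ≡⟨ unit (expectOver p Hs (F t)) (expectOver p Hs S) ⟨
  expectOver p Hs (F t) + expectOver p Hs S
    ≡⟨ cong (expectOver p Hs (F t) +_) (expectOver-sum p Hs F ts) ⟩
  expectOver p Hs (F t) + sumℚ (map (λ t → expectOver p Hs (F t)) ts) ∎
  where
  open ≡-Reasoning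
  S : List Edge → ℚ
  S es = sumℚ (map (λ t → F t es) ts)
  unit : ∀ x y → x + y ≡ 1ℚ * x + 1ℚ * y
  unit = solve-∀ ℚ-ring

weight : ℚ → (Edge → ℚ) → Quad → ℚ
weight p m H = sumℚ (map (λ k → ⅙ * (p * m (pairOf H k)) + ⅙ * (1ℚ - p)) allFin6)

expectOver-multiplicative : ∀ p Hs (m : Edge → ℚ) (f : List Edge → ℚ) →
  (∀ e es → f (e ∷ es) ≡ m e * f es) →
  expectOver p Hs f ≡ prodℚ (map (weight p m) Hs) * f []
expectOver-multiplicative p []       m f f-mult = sym (*-identityˡ (f []))
expectOver-multiplicative p (H ∷ Hs) m f f-mult = begin
  sumℚ (map (λ k → ⅙ * (p * expectOver p Hs (λ es → f (pairOf H k ∷ es))) + ⅙ * ((1ℚ - p) * E))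
            allFin6)
    ≡⟨ cong sumℚ (map-cong (λ k → trans
         (cong (λ a → ⅙ * (p * a) + ⅙ * ((1ℚ - p) * E))
               (trans (expectOver-cong p Hs (f-mult (pairOf H k))) (expectOver-scale p Hs (m (pairOf H k)) f)))
         (factor ⅙ p (m (pairOf H k)) E)) allFin6) ⟩
  sumℚ (map (λ k → (⅙ * (p * m (pairOf H k)) + ⅙ * (1ℚ - p)) * E) allFin6)
    ≡⟨ sumℚ-*ʳ (λ k → ⅙ * (p * m (pairOf H k)) + ⅙ * (1ℚ - p)) E allFin6 ⟩
  weight p m H * E
    ≡⟨ cong (weight p m H *_) (expectOver-multiplicative p Hs m f f-mult) ⟩
  weight p m H * (prodℚ (map (weight p m) Hs) * f [])
    ≡⟨ *-assoc (weight p m H) _ (f []) ⟨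
  prodℚ (map (weight p m) (H ∷ Hs)) * f [] ∎
  where
  open ≡-Reasoning
  E : ℚ
  E = expectOver p Hs f
  factor : ∀ c p μ E → c * (p * (μ * E)) + c * ((1ℚ - p) * E) ≡ (c * (p * μ) + c * (1ℚ - p)) * E
  factor = solve-∀ ℚ-ring

count-≡ᵇ : ∀ {L} y → Unique L → count (ℕ._≡ᵇ y) L ≡ 𝟙 (y ∈ᵇ L)
count-≡ᵇ y []                                          = refl
count-≡ᵇ {a ∷ L} y (a∉L ∷ unique) with a ℕ.≡ᵇ y in a≡y
... | true  =
  cong suc (count-none (All.map (λ a≢b → ≢⇒≡ᵇ-false (a≢b ∘ trans (≡ᵇ⇒≡ a y a≡y) ∘ sym)) a∉L))
... | false = count-≡ᵇ y unique

pairs : List ℕ → List Edge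
pairs []      = []
pairs (a ∷ L) = map (a ,_) L ++ pairs L

matches : ℕ → ℕ → Edge → Bool
matches x y (s , t) = ((s ℕ.≡ᵇ x) ∧ (t ℕ.≡ᵇ y)) ∨ ((s ℕ.≡ᵇ y) ∧ (t ℕ.≡ᵇ x))

count-matches-pairs : ∀ {x y} L → Unique L → x ≢ y →
  count (matches x y) (pairs L) ≡ 𝟙 (x ∈ᵇ L ∧ y ∈ᵇ L)
count-matches-pairs         []      []             x≢y = refl
count-matches-pairs {x} {y} (a ∷ L) (a∉L ∷ unique) x≢y = begin
  count (matches x y) (map (a ,_) L ++ pairs L)
    ≡⟨ count-++ (matches x y) (map (a ,_) L) (pairs L) ⟩
  count (matches x y) (map (a ,_) L) ℕ.+ count (matches x y) (pairs L)
    ≡⟨ cong₂ ℕ._+_ (count-map (matches x y) (a ,_) L) (count-matches-pairs L unique x≢y) ⟩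
  count (λ t → matches x y (a , t)) L ℕ.+ 𝟙 (x ∈ᵇ L ∧ y ∈ᵇ L)
    ≡⟨ through-a ⟩
  𝟙 (x ∈ᵇ (a ∷ L) ∧ y ∈ᵇ (a ∷ L)) ∎
  where
  open ≡-Reasoning
  ∉L : ∀ {z} → a ≡ z → z ∈ᵇ L ≡ false
  ∉L refl = ∈ᵇ-false (All.map (λ a≢b b≡a → a≢b (sym b≡a)) a∉L)
  through-a : count (λ t → matches x y (a , t)) L ℕ.+ 𝟙 (x ∈ᵇ L ∧ y ∈ᵇ L)
              ≡ 𝟙 (x ∈ᵇ (a ∷ L) ∧ y ∈ᵇ (a ∷ L))
  through-a with a ℕ.≡ᵇ x in a≡x | a ℕ.≡ᵇ y in a≡y
  ... | true  | true  = ⊥-elim (x≢y (trans (sym (≡ᵇ⇒≡ a x a≡x)) (≡ᵇ⇒≡ a y a≡y)))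
  ... | true  | false rewrite ∉L (≡ᵇ⇒≡ a x a≡x) =
    trans (ℕ.+-identityʳ _)
          (trans (count-cong (λ t → ∨-identityʳ (t ℕ.≡ᵇ y)) L) (count-≡ᵇ y unique))
  ... | false | true  rewrite ∉L (≡ᵇ⇒≡ a y a≡y) | ∧-zeroʳ (x ∈ᵇ L) | ∧-identityʳ (x ∈ᵇ L) =
    trans (ℕ.+-identityʳ _) (count-≡ᵇ x unique)
  ... | false | false = cong (ℕ._+ 𝟙 (x ∈ᵇ L ∧ y ∈ᵇ L)) (count-none (All.universal (λ _ → refl) L))

matches⇒ : ∀ {x y} s t → T (matches x y (s , t)) → (s ≡ x × t ≡ y) ⊎ (s ≡ y × t ≡ x)
matches⇒ {x} {y} s t m with Equivalence.to T-∨ m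
... | inj₁ st = let s≡x , t≡y = Equivalence.to T-∧ st
               in inj₁ (ℕ.≡ᵇ⇒≡ s x s≡x , ℕ.≡ᵇ⇒≡ t y t≡y)
... | inj₂ st = let s≡y , t≡x = Equivalence.to T-∧ st
               in inj₂ (ℕ.≡ᵇ⇒≡ s y s≡y , ℕ.≡ᵇ⇒≡ t x t≡x)

matches-partner : ∀ {x y z} e → T (matches x y e) → T (matches x z e) → y ≡ z
matches-partner (s , t) mxy mxz with matches⇒ s t mxy | matches⇒ s t mxz
... | inj₁ (_   , t≡y) | inj₁ (_   , t≡z) = trans (sym t≡y) t≡z
... | inj₁ (s≡x , t≡y) | inj₂ (s≡z , t≡x) = trans (sym t≡y) (trans t≡x (trans (sym s≡x) s≡z))
... | inj₂ (s≡y , t≡x) | inj₁ (s≡x , t≡z) = trans (sym s≡y) (trans s≡x (trans (sym t≡x) t≡z))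
... | inj₂ (s≡y , _)   | inj₂ (s≡z , _)   = trans (sym s≡y) s≡z

matches-sym : ∀ x y e → matches x y e ≡ matches y x e
matches-sym x y (s , t) = ∨-comm ((s ℕ.≡ᵇ x) ∧ (t ℕ.≡ᵇ y)) ((s ℕ.≡ᵇ y) ∧ (t ℕ.≡ᵇ x))

-- A mask selects which of the pairs ij, ik, jk of a triangle i, j, k are required to stay unjoined.
Mask : Set
Mask = Bool × Bool × Bool

selected : Mask → Bool → Bool → Bool → Bool
selected (u , v , w) a b c = (u ∧ a) ∨ ((v ∧ b) ∨ (w ∧ c))

hits : ℕ → ℕ → ℕ → Mask → Edge → Bool
hits i j k S e = selected S (matches i j e) (matches i k e) (matches j k e)

hitsWithin : Mask → Bool → Bool → Bool → ℕ
hitsWithin (u , v , w) a b c = 𝟙 ((a ∧ b) ∧ u) ℕ.+ (𝟙 ((a ∧ c) ∧ v) ℕ.+ 𝟙 ((b ∧ c) ∧ w))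

count-hits-pairs : ∀ {i j k} H → Unique H → i ≢ j → i ≢ k → j ≢ k → ∀ S →
  count (hits i j k S) (pairs H) ≡ hitsWithin S (i ∈ᵇ H) (j ∈ᵇ H) (k ∈ᵇ H)
count-hits-pairs {i} {j} {k} H unique i≢j i≢k j≢k (u , v , w) = begin
  count (hits i j k (u , v , w)) (pairs H)
    ≡⟨ count-∨ ij-vs-rest (pairs H) ⟩
  count (λ e → u ∧ matches i j e) (pairs H)
    ℕ.+ count (λ e → (v ∧ matches i k e) ∨ (w ∧ matches j k e)) (pairs H)
    ≡⟨ cong (_ ℕ.+_) (count-∨ ik-vs-jk (pairs H)) ⟩
  count (λ e → u ∧ matches i j e) (pairs H)
    ℕ.+ (count (λ e → v ∧ matches i k e) (pairs H) ℕ.+ count (λ e → w ∧ matches j k e) (pairs H))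
    ≡⟨ cong₂ ℕ._+_ (gated u i≢j) (cong₂ ℕ._+_ (gated v i≢k) (gated w j≢k)) ⟩
  hitsWithin (u , v , w) (i ∈ᵇ H) (j ∈ᵇ H) (k ∈ᵇ H) ∎
  where
  open ≡-Reasoning
  second : ∀ a {b} → T (a ∧ b) → T b
  second a = proj₂ ∘ Equivalence.to (T-∧ {a})
  flip : ∀ {x y} e → T (matches x y e) → T (matches y x e)
  flip {x} {y} e = subst T (matches-sym x y e)
  ij-vs-rest : ∀ e → T (u ∧ matches i j e) → T ((v ∧ matches i k e) ∨ (w ∧ matches j k e)) → ⊥
  ij-vs-rest e ij rest with Equivalence.to T-∨ rest
  ... | inj₁ ik = j≢k (matches-partner e (second u ij) (second v ik))
  ... | inj₂ jk = i≢k (matches-partner e (flip e (second u ij)) (second w jk))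
  ik-vs-jk : ∀ e → T (v ∧ matches i k e) → T (w ∧ matches j k e) → ⊥
  ik-vs-jk e ik jk = i≢j (matches-partner e (flip e (second v ik)) (flip e (second w jk)))
  gated : ∀ b {x y} → x ≢ y →
    count (λ e → b ∧ matches x y e) (pairs H) ≡ 𝟙 ((x ∈ᵇ H ∧ y ∈ᵇ H) ∧ b)
  gated true  {x} {y} x≢y rewrite ∧-identityʳ (x ∈ᵇ H ∧ y ∈ᵇ H) = count-matches-pairs H unique x≢y
  gated false {x} {y} x≢y rewrite ∧-zeroʳ (x ∈ᵇ H ∧ y ∈ᵇ H) =
    count-none (All.universal (λ _ → refl) (pairs H))

avoidChance : ℚ → ℕ → ℚ
avoidChance p c = 1ℚ - ℕtoℚ c * (p * ⅙)

weight-avoiding : ∀ p (P : Edge → Bool) H →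
  weight p (𝟙ℚ ∘ not ∘ P) H ≡ avoidChance p (count P (map (pairOf H) allFin6))
weight-avoiding p P H = trans (sum-avoiding (map (pairOf H) allFin6)) (sixths p _)
  where
  sixths : ∀ p c → ⅙ * (ℕtoℚ 6 - p * c) ≡ 1ℚ - c * (p * ⅙)
  sixths = solve-∀ ℚ-ring
  sum-avoiding : ∀ es → sumℚ (map (λ e → ⅙ * (p * 𝟙ℚ (not (P e))) + ⅙ * (1ℚ - p)) es)
                        ≡ ⅙ * (ℕtoℚ (length es) - p * ℕtoℚ (count P es))
  sum-avoiding []       = none p
    where
    none : ∀ p → 0ℚ ≡ ⅙ * (0ℚ - p * 0ℚ)
    none = solve-∀ ℚ-ring
  sum-avoiding (e ∷ es) with P e
  ... | true  = trans (cong (⅙ * (p * 0ℚ) + ⅙ * (1ℚ - p) +_) (sum-avoiding es))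
                      (trans (hit p (ℕtoℚ (length es)) (ℕtoℚ (count P es)))
                             (sym (cong₂ (λ l c → ⅙ * (l - p * c))
                                         (ℕtoℚ-+ 1 (length es)) (ℕtoℚ-+ 1 (count P es)))))
    where
    hit : ∀ p l c →
      ⅙ * (p * 0ℚ) + ⅙ * (1ℚ - p) + ⅙ * (l - p * c) ≡ ⅙ * ((1ℚ + l) - p * (1ℚ + c))
    hit = solve-∀ ℚ-ring
  ... | false = trans (cong (⅙ * (p * 1ℚ) + ⅙ * (1ℚ - p) +_) (sum-avoiding es))
                      (trans (miss p (ℕtoℚ (length es)) (ℕtoℚ (count P es)))
                             (sym (cong (λ l → ⅙ * (l - p * ℕtoℚ (count P es))) (ℕtoℚ-+ 1 (length es)))))
    where
    miss : ∀ p l c → ⅙ * (p * 1ℚ) + ⅙ * (1ℚ - p) + ⅙ * (l - p * c) ≡ ⅙ * ((1ℚ + l) - p * c)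
    miss = solve-∀ ℚ-ring

avoidChance-zero : ∀ p → avoidChance p 0 ≡ 1ℚ
avoidChance-zero = no-pairs
  where
  no-pairs : ∀ p → 1ℚ - ℕtoℚ 0 * (p * ⅙) ≡ 1ℚ
  no-pairs = solve-∀ ℚ-ring

-- The probability of a fixed triangle

any-selected : ∀ S (P Q R : A → Bool) xs →
  any (λ x → selected S (P x) (Q x) (R x)) xs ≡ selected S (any P xs) (any Q xs) (any R xs)
any-selected (u , v , w) P Q R xs = begin
  any (λ x → (u ∧ P x) ∨ ((v ∧ Q x) ∨ (w ∧ R x))) xs
    ≡⟨ any-∨ (λ x → u ∧ P x) _ xs ⟩
  any (λ x → u ∧ P x) xs ∨ any (λ x → (v ∧ Q x) ∨ (w ∧ R x)) xs
    ≡⟨ cong (any (λ x → u ∧ P x) xs ∨_) (any-∨ (λ x → v ∧ Q x) (λ x → w ∧ R x) xs) ⟩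
  any (λ x → u ∧ P x) xs ∨ (any (λ x → v ∧ Q x) xs ∨ any (λ x → w ∧ R x) xs)
    ≡⟨ cong₂ _∨_ (any-∧ u P xs) (cong₂ _∨_ (any-∧ v Q xs) (any-∧ w R xs)) ⟩
  (u ∧ any P xs) ∨ ((v ∧ any Q xs) ∨ (w ∧ any R xs)) ∎
  where open ≡-Reasoning

masks : List Mask
masks = (true , true , true)
      ∷ (true , true , false) ∷ (true , false , true) ∷ (false , true , true)
      ∷ (true , false , false) ∷ (false , true , false) ∷ (false , false , true)
      ∷ (false , false , false) ∷ []

sign : Mask → ℚ
sign (u , v , w) = (- 1ℚ) ^ℚ (𝟙 u ℕ.+ (𝟙 v ℕ.+ 𝟙 w))

inclusion–exclusion : ∀ a b c →
  𝟙ℚ (a ∧ b ∧ c) ≡ sumℚ (map (λ S → sign S * 𝟙ℚ (not (selected S a b c))) masks)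
inclusion–exclusion true  true  true  = refl
inclusion–exclusion true  true  false = refl
inclusion–exclusion true  false true  = refl
inclusion–exclusion true  false false = refl
inclusion–exclusion false true  true  = refl
inclusion–exclusion false true  false = refl
inclusion–exclusion false false true  = refl
inclusion–exclusion false false false = refl

avoiding : ℕ → ℕ → ℕ → Mask → List Edge → ℚ
avoiding i j k S es = 𝟙ℚ (not (any (hits i j k S) es))

𝟙ℚ-not-∨ : ∀ a b → 𝟙ℚ (not (a ∨ b)) ≡ 𝟙ℚ (not a) * 𝟙ℚ (not b)
𝟙ℚ-not-∨ true  true  = refl
𝟙ℚ-not-∨ true  false = refl
𝟙ℚ-not-∨ false true  = refl
𝟙ℚ-not-∨ false false = refl

triangle-inclusion–exclusion : ∀ es i j k →
  𝟙ℚ (isTriangle es (i ∷ j ∷ k ∷ [])) ≡ sumℚ (map (λ S → sign S * avoiding i j k S es) masks)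
triangle-inclusion–exclusion es i j k =
  trans (inclusion–exclusion (joined es i j) (joined es i k) (joined es j k))
        (cong sumℚ (map-cong (λ S → cong (λ b → sign S * 𝟙ℚ (not b))
                                         (sym (any-selected S (matches i j) (matches i k) (matches j k) es)))
                             masks))

maskValue : (ℕ → ℚ) → ℕ → ℕ → Mask → ℚ
maskValue a N M S =
  φ true true true ^ℚ N * (φ true true false ^ℚ M * (φ true false true ^ℚ M * φ false true true ^ℚ M))
  where
  φ : Bool → Bool → Bool → ℚ
  φ x y z = a (hitsWithin S x y z)

inclusionExclusion : (ℕ → ℚ) → ℕ → ℕ → ℚ
inclusionExclusion a N M =
  1ℚ - ℕtoℚ 3 * (D * a 1 ^ℚ N) + ℕtoℚ 3 * (D * D * a 2 ^ℚ N) - D * D * D * a 3 ^ℚ N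
  where
  D : ℚ
  D = a 1 ^ℚ M

maskSum : ∀ (a : ℕ → ℚ) N M → a 0 ≡ 1ℚ →
  sumℚ (map (λ S → sign S * maskValue a N M S) masks) ≡ inclusionExclusion a N M
maskSum a N M a₀≡1 rewrite a₀≡1 | 1^ℚ N | 1^ℚ M =
  expand (a 1 ^ℚ N) (a 2 ^ℚ N) (a 3 ^ℚ N) (a 1 ^ℚ M)
  where
  expand : ∀ K₁ K₂ K₃ D →
      (- 1ℚ) * ((- 1ℚ) * ((- 1ℚ) * 1ℚ)) * (K₃ * (D * (D * D)))
    + ((- 1ℚ) * ((- 1ℚ) * 1ℚ) * (K₂ * (D * (D * 1ℚ)))
    + ((- 1ℚ) * ((- 1ℚ) * 1ℚ) * (K₂ * (D * (1ℚ * D)))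
    + ((- 1ℚ) * ((- 1ℚ) * 1ℚ) * (K₂ * (1ℚ * (D * D)))
    + ((- 1ℚ) * 1ℚ * (K₁ * (D * (1ℚ * 1ℚ)))
    + ((- 1ℚ) * 1ℚ * (K₁ * (1ℚ * (D * 1ℚ)))
    + ((- 1ℚ) * 1ℚ * (K₁ * (1ℚ * (1ℚ * D)))
    + (1ℚ * (1ℚ * (1ℚ * (1ℚ * 1ℚ)))
    + 0ℚ)))))))
    ≡ 1ℚ - ℕtoℚ 3 * (D * K₁) + ℕtoℚ 3 * (D * D * K₂) - D * D * D * K₃
  expand = solve-∀ ℚ-ring

triangleProbability : ℚ → ℕ → ℚ
triangleProbability p N = inclusionExclusion (avoidChance p) N (N C 2)

module FixedTriangle (n : ℕ) (p : ℚ) {i j k : ℕ} (ijk⊆[n] : i ∷ j ∷ k ∷ [] ⊆ [ n ]) where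

  N : ℕ
  N = n ℕ.∸ 3

  fourSets : List (Vec ℕ 4)
  fourSets = combinations 4 [ n ]

  sorted : Sorted [ n ]
  sorted = Sorted-[n] n

  i≢j : i ≢ j
  i≢j with Sorted-resp-⊆ ijk⊆[n] sorted
  ... | (i<j ∷ _) ∷ _ = ℕ.<⇒≢ i<j

  i≢k : i ≢ k
  i≢k with Sorted-resp-⊆ ijk⊆[n] sorted
  ... | (_ ∷ i<k ∷ _) ∷ _ = ℕ.<⇒≢ i<k

  j≢k : j ≢ k
  j≢k with Sorted-resp-⊆ ijk⊆[n] sorted
  ... | _ ∷ (j<k ∷ _) ∷ _ = ℕ.<⇒≢ j<k

  _∈ᵛ_ : ℕ → Vec ℕ 4 → Bool
  x ∈ᵛ H = x ∈ᵇ toList H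

  avoidFactor : Mask → Bool → Bool → Bool → ℚ
  avoidFactor S a b c = avoidChance p (hitsWithin S a b c)

  expectOver-avoiding-product : ∀ S →
    expectOver p (quads n) (avoiding i j k S)
      ≡ prodℚ (map (λ H → avoidFactor S (i ∈ᵛ H) (j ∈ᵛ H) (k ∈ᵛ H)) fourSets)
  expectOver-avoiding-product S = begin
    expectOver p (quads n) (avoiding i j k S)
      ≡⟨ expectOver-multiplicative p (quads n) (𝟙ℚ ∘ not ∘ hits i j k S) (avoiding i j k S)
                                   (λ e es → 𝟙ℚ-not-∨ (hits i j k S e) (any (hits i j k S) es)) ⟩
    prodℚ (map w (quads n)) * 1ℚ
      ≡⟨ *-identityʳ _ ⟩
    prodℚ (map w (quads n))
      ≡⟨ cong (prodℚ ∘ map w) (quads-combinations n) ⟩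
    prodℚ (map w (map toQuad fourSets))
      ≡⟨ cong prodℚ (map-∘ {g = w} {f = toQuad} fourSets) ⟨
    prodℚ (map (w ∘ toQuad) fourSets)
      ≡⟨ prodℚ-cong (All.map per-quad (combinations-⊆ 4 [ n ])) ⟩
    prodℚ (map (λ H → avoidFactor S (i ∈ᵛ H) (j ∈ᵛ H) (k ∈ᵛ H)) fourSets) ∎
    where
    open ≡-Reasoning
    w : Quad → ℚ
    w = weight p (𝟙ℚ ∘ not ∘ hits i j k S)
    per-quad : ∀ {H} → toList H ⊆ [ n ] →
      w (toQuad H) ≡ avoidFactor S (i ∈ᵛ H) (j ∈ᵛ H) (k ∈ᵛ H)
    per-quad {a ∷ b ∷ c ∷ d ∷ []} H⊆[n] =
      -- map (pairOf (a , b , c , d)) allFin6 computes to pairs (a ∷ b ∷ c ∷ d ∷ []).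
      trans (weight-avoiding p (hits i j k S) (a , b , c , d))
            (cong (avoidChance p)
                  (count-hits-pairs (a ∷ b ∷ c ∷ d ∷ []) (Sorted⇒Unique (Sorted-resp-⊆ H⊆[n] sorted))
                                    i≢j i≢k j≢k S))

  count-all-three : count (λ H → i ∈ᵛ H ∧ j ∈ᵛ H ∧ k ∈ᵛ H) fourSets ≡ N
  count-all-three = trans (count-containing-triple sorted ijk⊆[n]) (cong (ℕ._∸ 3) (length-[n] n))

  count-exactly : ∀ {x y} z → x ∷ y ∷ [] ⊆ [ n ] →
    (∀ H → (x ∈ᵛ H ∧ y ∈ᵛ H) ∧ z ∈ᵛ H ≡ i ∈ᵛ H ∧ j ∈ᵛ H ∧ k ∈ᵛ H) →
    count (λ H → (x ∈ᵛ H ∧ y ∈ᵛ H) ∧ not (z ∈ᵛ H)) fourSets ≡ N C 2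
  count-exactly z xy⊆[n] same-triple = trans
    (count-containing-exactly-pair z sorted xy⊆[n] (length-mono-≤ ijk⊆[n])
       (trans (count-cong same-triple fourSets) (count-containing-triple sorted ijk⊆[n])))
    (cong (λ m → (m ℕ.∸ 3) C 2) (length-[n] n))

  expectOver-avoiding : ∀ S →
    expectOver p (quads n) (avoiding i j k S) ≡ maskValue (avoidChance p) N (N C 2) S
  expectOver-avoiding S = begin
    expectOver p (quads n) (avoiding i j k S)
      ≡⟨ expectOver-avoiding-product S ⟩
    prodℚ (map (λ H → φ (i ∈ᵛ H) (j ∈ᵛ H) (k ∈ᵛ H)) fourSets)
      ≡⟨ prodℚ-patterns φ a₀ a₀ a₀ a₀ (i ∈ᵛ_) (j ∈ᵛ_) (k ∈ᵛ_) fourSets ⟩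
    φ true true true ^ℚ count (λ H → i ∈ᵛ H ∧ j ∈ᵛ H ∧ k ∈ᵛ H) fourSets
      * (φ true true false ^ℚ count (λ H → (i ∈ᵛ H ∧ j ∈ᵛ H) ∧ not (k ∈ᵛ H)) fourSets
      * (φ true false true ^ℚ count (λ H → (i ∈ᵛ H ∧ k ∈ᵛ H) ∧ not (j ∈ᵛ H)) fourSets
      * φ false true true ^ℚ count (λ H → (j ∈ᵛ H ∧ k ∈ᵛ H) ∧ not (i ∈ᵛ H)) fourSets))
      ≡⟨ cong₂ (λ c₁ c → φ true true true ^ℚ c₁ * c) count-all-three
           (cong₂ (λ c₂ c → φ true true false ^ℚ c₂ * c) (count-exactly k ij⊆[n] ij-k)
             (cong₂ (λ c₃ c₄ → φ true false true ^ℚ c₃ * φ false true true ^ℚ c₄)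
                    (count-exactly j ik⊆[n] ik-j) (count-exactly i jk⊆[n] jk-i))) ⟩
    maskValue (avoidChance p) N (N C 2) S ∎
    where
    open ≡-Reasoning
    φ : Bool → Bool → Bool → ℚ
    φ = avoidFactor S
    a₀ : avoidChance p 0 ≡ 1ℚ
    a₀ = avoidChance-zero p
    ij⊆[n] : i ∷ j ∷ [] ⊆ [ n ]
    ij⊆[n] = ⊆-trans (refl ∷ refl ∷ k ∷ʳ []) ijk⊆[n]
    ik⊆[n] : i ∷ k ∷ [] ⊆ [ n ]
    ik⊆[n] = ⊆-trans (refl ∷ j ∷ʳ refl ∷ []) ijk⊆[n]
    jk⊆[n] : j ∷ k ∷ [] ⊆ [ n ]
    jk⊆[n] = ⊆-trans (i ∷ʳ refl ∷ refl ∷ []) ijk⊆[n]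
    ij-k : ∀ H → (i ∈ᵛ H ∧ j ∈ᵛ H) ∧ k ∈ᵛ H ≡ i ∈ᵛ H ∧ j ∈ᵛ H ∧ k ∈ᵛ H
    ij-k H = ∧-assoc (i ∈ᵛ H) _ _
    ik-j : ∀ H → (i ∈ᵛ H ∧ k ∈ᵛ H) ∧ j ∈ᵛ H ≡ i ∈ᵛ H ∧ j ∈ᵛ H ∧ k ∈ᵛ H
    ik-j H = trans (∧-assoc (i ∈ᵛ H) _ _) (cong (i ∈ᵛ H ∧_) (∧-comm (k ∈ᵛ H) _))
    jk-i : ∀ H → (j ∈ᵛ H ∧ k ∈ᵛ H) ∧ i ∈ᵛ H ≡ i ∈ᵛ H ∧ j ∈ᵛ H ∧ k ∈ᵛ H
    jk-i H = ∧-comm (j ∈ᵛ H ∧ k ∈ᵛ H) _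

  probability :
    expectOver p (quads n) (λ es → 𝟙ℚ (isTriangle es (i ∷ j ∷ k ∷ []))) ≡ triangleProbability p N
  probability = begin
    expectOver p (quads n) (λ es → 𝟙ℚ (isTriangle es (i ∷ j ∷ k ∷ [])))
      ≡⟨ expectOver-cong p (quads n) (λ es → triangle-inclusion–exclusion es i j k) ⟩
    expectOver p (quads n) (λ es → sumℚ (map (λ S → sign S * avoiding i j k S es) masks))
      ≡⟨ expectOver-sum p (quads n) (λ S es → sign S * avoiding i j k S es) masks ⟩
    sumℚ (map (λ S → expectOver p (quads n) (λ es → sign S * avoiding i j k S es)) masks)
      ≡⟨ cong sumℚ (map-cong (λ S → trans (expectOver-scale p (quads n) (sign S) (avoiding i j k S))
                                           (cong (sign S *_) (expectOver-avoiding S))) masks) ⟩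
    sumℚ (map (λ S → sign S * maskValue (avoidChance p) N (N C 2) S) masks)
      ≡⟨ maskSum (avoidChance p) N (N C 2) (avoidChance-zero p) ⟩
    triangleProbability p N ∎
    where open ≡-Reasoning

triangle-probability : ∀ n p (T : Vec ℕ 3) → toList T ⊆ [ n ] →
  expectOver p (quads n) (λ es → 𝟙ℚ (isTriangle es T)) ≡ triangleProbability p (n ℕ.∸ 3)
triangle-probability n p (i ∷ j ∷ k ∷ []) T⊆[n] = FixedTriangle.probability n p T⊆[n]

-- The right-hand side

_·_ : Mat → (Fin 4 → ℚ) → Fin 4 → ℚ
(A · v) i = ∑[ j < 4 ] (A i j * v j)

∑-δ : ∀ {n} (v : Fin n → ℚ) i → ∑[ j < n ] ((if toℕ i ℕ.≡ᵇ toℕ j then 1ℚ else 0ℚ) * v j) ≡ v i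
∑-δ {suc n} v zero    = begin
  1ℚ * v zero + ∑[ j < n ] (0ℚ * v (suc j))
    ≡⟨ cong (1ℚ * v zero +_) (sum-cong-≗ (λ j → *-zeroˡ (v (suc j)))) ⟩
  1ℚ * v zero + ∑[ j < n ] 0ℚ
    ≡⟨ cong (1ℚ * v zero +_) (sum-replicate-zero n) ⟩
  1ℚ * v zero + 0ℚ
    ≡⟨ cleanup (v zero) ⟩
  v zero ∎
  where
  open ≡-Reasoning
  cleanup : ∀ x → 1ℚ * x + 0ℚ ≡ x
  cleanup = solve-∀ ℚ-ring
∑-δ {suc n} v (suc i) = trans (cong (0ℚ * v zero +_) (∑-δ (v ∘ suc) i)) (cleanup (v zero) (v (suc i)))
  where
  cleanup : ∀ x y → 0ℚ * x + y ≡ y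
  cleanup = solve-∀ ℚ-ring

idMat-· : ∀ v i → (idMat · v) i ≡ v i
idMat-· = ∑-δ

matMul-· : ∀ A B v i → (matMul A B · v) i ≡ (A · (B · v)) i
matMul-· A B v i = begin
  ∑[ j < 4 ] (∑[ k < 4 ] (A i k * B k j) * v j)
    ≡⟨ sum-cong-≗ (λ j → *-distribʳ-sum (v j) (λ k → A i k * B k j)) ⟩
  ∑[ j < 4 ] ∑[ k < 4 ] (A i k * B k j * v j)
    ≡⟨ ∑-comm (λ j k → A i k * B k j * v j) ⟩
  ∑[ k < 4 ] ∑[ j < 4 ] (A i k * B k j * v j)
    ≡⟨ sum-cong-≗ (λ k → sum-cong-≗ (λ j → *-assoc (A i k) (B k j) (v j))) ⟩
  ∑[ k < 4 ] ∑[ j < 4 ] (A i k * (B k j * v j))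
    ≡⟨ sum-cong-≗ (λ k → *-distribˡ-sum (A i k) (λ j → B k j * v j)) ⟨
  ∑[ k < 4 ] (A i k * ∑[ j < 4 ] (B k j * v j)) ∎
  where open ≡-Reasoning

·-scale : ∀ A c v i → (A · (λ j → c * v j)) i ≡ c * (A · v) i
·-scale A c v i = begin
  ∑[ j < 4 ] (A i j * (c * v j))   ≡⟨ sum-cong-≗ (λ j → swap (A i j) c (v j)) ⟩
  ∑[ j < 4 ] (c * (A i j * v j))   ≡⟨ *-distribˡ-sum c (λ j → A i j * v j) ⟨
  c * ∑[ j < 4 ] (A i j * v j)     ∎
  where
  open ≡-Reasoning
  swap : ∀ a c x → a * (c * x) ≡ c * (a * x)
  swap = solve-∀ ℚ-ring

matPow-eigen : ∀ A v μ → (∀ i → (A · v) i ≡ μ * v i) →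
  ∀ N i → (matPow A N · v) i ≡ μ ^ℚ N * v i
matPow-eigen A v μ eigen zero    i = trans (idMat-· v i) (sym (*-identityˡ (v i)))
matPow-eigen A v μ eigen (suc N) i = begin
  (matMul A (matPow A N) · v) i
    ≡⟨ matMul-· A (matPow A N) v i ⟩
  (A · (matPow A N · v)) i
    ≡⟨ sum-cong-≗ (λ j → cong (A i j *_) (matPow-eigen A v μ eigen N j)) ⟩
  (A · (λ j → μ ^ℚ N * v j)) i
    ≡⟨ ·-scale A (μ ^ℚ N) v i ⟩
  μ ^ℚ N * (A · v) i
    ≡⟨ cong (μ ^ℚ N *_) (eigen i) ⟩
  μ ^ℚ N * (μ * v i)
    ≡⟨ shift (μ ^ℚ N) μ (v i) ⟩
  μ * μ ^ℚ N * v i ∎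
  where
  open ≡-Reasoning
  shift : ∀ M μ x → M * (μ * x) ≡ μ * M * x
  shift = solve-∀ ℚ-ring

-- The rate matrix of the number of joined pairs of a fixed triangle: each unjoined pair is joined at rate 1.
generator : Mat
generator 0F 0F = - ℕtoℚ 3
generator 0F 1F = ℕtoℚ 3
generator 1F 1F = - ℕtoℚ 2
generator 1F 2F = ℕtoℚ 2
generator 2F 2F = - 1ℚ
generator 2F 3F = 1ℚ
generator _  _  = 0ℚ

transP-generator : ∀ p v i → (transP p · v) i ≡ v i + p * ⅙ * (generator · v) i
transP-generator p v 0F = row₀ p (v 0F) (v 1F) (v 2F) (v 3F)
  where
  row₀ : ∀ p a b c d →
    (1ℚ - p * (ℤ.+ 1 / 2)) * a + (p * (ℤ.+ 1 / 2) * b + (0ℚ * c + (0ℚ * d + 0ℚ)))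
      ≡ a + p * ⅙ * (- ℕtoℚ 3 * a + (ℕtoℚ 3 * b + (0ℚ * c + (0ℚ * d + 0ℚ))))
  row₀ = solve-∀ ℚ-ring
transP-generator p v 1F = row₁ p (v 0F) (v 1F) (v 2F) (v 3F)
  where
  row₁ : ∀ p a b c d →
    0ℚ * a + ((1ℚ - p * (ℤ.+ 1 / 3)) * b + (p * (ℤ.+ 1 / 3) * c + (0ℚ * d + 0ℚ)))
      ≡ b + p * ⅙ * (0ℚ * a + (- ℕtoℚ 2 * b + (ℕtoℚ 2 * c + (0ℚ * d + 0ℚ))))
  row₁ = solve-∀ ℚ-ring
transP-generator p v 2F = row₂ p (v 0F) (v 1F) (v 2F) (v 3F)
  where
  row₂ : ∀ p a b c d →
    0ℚ * a + (0ℚ * b + ((1ℚ - p * (ℤ.+ 1 / 6)) * c + (p * (ℤ.+ 1 / 6) * d + 0ℚ)))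
      ≡ c + p * ⅙ * (0ℚ * a + (0ℚ * b + (- 1ℚ * c + (1ℚ * d + 0ℚ))))
  row₂ = solve-∀ ℚ-ring
transP-generator p v 3F = row₃ p (v 0F) (v 1F) (v 2F) (v 3F)
  where
  row₃ : ∀ p a b c d →
    0ℚ * a + (0ℚ * b + (0ℚ * c + (1ℚ * d + 0ℚ)))
      ≡ d + p * ⅙ * (0ℚ * a + (0ℚ * b + (0ℚ * c + (0ℚ * d + 0ℚ))))
  row₃ = solve-∀ ℚ-ring

eigenvector : Fin 4 → Fin 4 → ℚ
eigenvector m j = ℕtoℚ ((3 ℕ.∸ toℕ j) C toℕ m)

generator-eigen : ∀ m i → (generator · eigenvector m) i ≡ - ℕtoℚ (toℕ m) * eigenvector m i
generator-eigen =
  toWitness {a? = all? λ m → all? λ i → (generator · eigenvector m) i ≟ - ℕtoℚ (toℕ m) * eigenvector m i} tt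

transP-eigen : ∀ p m i → (transP p · eigenvector m) i ≡ avoidChance p (toℕ m) * eigenvector m i
transP-eigen p m i = begin
  (transP p · eigenvector m) i
    ≡⟨ transP-generator p (eigenvector m) i ⟩
  eigenvector m i + p * ⅙ * (generator · eigenvector m) i
    ≡⟨ cong (λ x → eigenvector m i + p * ⅙ * x) (generator-eigen m i) ⟩
  eigenvector m i + p * ⅙ * (- ℕtoℚ (toℕ m) * eigenvector m i)
    ≡⟨ regroup p (ℕtoℚ (toℕ m)) (eigenvector m i) ⟩
  avoidChance p (toℕ m) * eigenvector m i ∎
  where
  open ≡-Reasoning
  regroup : ∀ p c x → x + p * ⅙ * (- c * x) ≡ (1ℚ - c * (p * ⅙)) * x
  regroup = solve-∀ ℚ-ring

^≡^ℚ : ∀ x n → x ^ n ≡ x ^ℚ n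
^≡^ℚ x zero    = refl
^≡^ℚ x (suc n) = cong (x *_) (^≡^ℚ x n)

×ℚ≡ℕtoℚ* : ∀ n x → n ×ℚ x ≡ ℕtoℚ n * x
×ℚ≡ℕtoℚ* zero    x = sym (*-zeroˡ x)
×ℚ≡ℕtoℚ* (suc n) x = begin
  x + n ×ℚ x          ≡⟨ cong (x +_) (×ℚ≡ℕtoℚ* n x) ⟩
  x + ℕtoℚ n * x      ≡⟨ suc-* (ℕtoℚ n) x ⟩
  (1ℚ + ℕtoℚ n) * x   ≡⟨ cong (_* x) (ℕtoℚ-+ 1 n) ⟨
  ℕtoℚ (suc n) * x    ∎
  where
  open ≡-Reasoning
  suc-* : ∀ n x → x + n * x ≡ (1ℚ + n) * x
  suc-* = solve-∀ ℚ-ring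

sumℚ-applyUpTo : ∀ (f : ℕ → ℚ) m → sumℚ (applyUpTo f m) ≡ ∑[ i < m ] f (toℕ i)
sumℚ-applyUpTo f zero    = refl
sumℚ-applyUpTo f (suc m) = cong (f 0 +_) (sumℚ-applyUpTo (f ∘ suc) m)

binomial-split : ∀ m r → 1ℚ ≡ (1ℚ - r) ^ℚ m + binAtLeast1 m r
binomial-split m r = begin
  1ℚ
    ≡⟨ trans (sym (1^ℚ m)) (sym (^≡^ℚ 1ℚ m)) ⟩
  1ℚ ^ m
    ≡⟨ cong (_^ m) (split r) ⟨
  (r + (1ℚ - r)) ^ m
    ≡⟨ binomial-theorem m r (1ℚ - r) ⟩
  1ℚ * (1ℚ - r) ^ m + 0ℚ + ∑[ i < m ] binomialTerm r (1ℚ - r) m (suc i)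
    ≡⟨ cong₂ _+_ (trans (empty-term ((1ℚ - r) ^ m)) (^≡^ℚ (1ℚ - r) m)) (sum-cong-≗ {m} term) ⟩
  (1ℚ - r) ^ℚ m + ∑[ i < m ] binPMF m r (suc (toℕ i))
    ≡⟨ cong ((1ℚ - r) ^ℚ m +_) (sumℚ-applyUpTo (binPMF m r ∘ suc) m) ⟨
  (1ℚ - r) ^ℚ m + sumℚ (applyUpTo (binPMF m r ∘ suc) m)
    ≡⟨ cong (λ xs → (1ℚ - r) ^ℚ m + sumℚ xs) pmf-[m] ⟨
  (1ℚ - r) ^ℚ m + binAtLeast1 m r ∎
  where
  open ≡-Reasoning
  split : ∀ r → r + (1ℚ - r) ≡ 1ℚ
  split = solve-∀ ℚ-ring
  empty-term : ∀ x → 1ℚ * x + 0ℚ ≡ x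
  empty-term = solve-∀ ℚ-ring
  term : ∀ i → binomialTerm r (1ℚ - r) m (suc i) ≡ binPMF m r (suc (toℕ i))
  term i = trans (×ℚ≡ℕtoℚ* (m C suc (toℕ i)) (r ^ suc (toℕ i) * (1ℚ - r) ^ (m ℕ.∸ suc (toℕ i))))
                 (cong₂ (λ a b → ℕtoℚ (m C suc (toℕ i)) * (a * b))
                        (^≡^ℚ r (suc (toℕ i))) (^≡^ℚ (1ℚ - r) (m ℕ.∸ suc (toℕ i))))
  pmf-[m] : map (binPMF m r) [ m ] ≡ applyUpTo (binPMF m r ∘ suc) m
  pmf-[m] = trans (cong (map (binPMF m r)) (map-applyUpTo id suc m)) (map-applyUpTo suc (binPMF m r) m)

binAtLeast1-complement : ∀ m r → binAtLeast1 m r ≡ 1ℚ - (1ℚ - r) ^ℚ m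
binAtLeast1-complement m r =
  trans (isolate ((1ℚ - r) ^ℚ m) (binAtLeast1 m r)) (cong (_- (1ℚ - r) ^ℚ m) (sym (binomial-split m r)))
  where
  isolate : ∀ s b → b ≡ (s + b) - s
  isolate = solve-∀ ℚ-ring

bracket-by-rows : ∀ q₀ q₁ q₂ q₃ D →
  (1ℚ - (q₀ + (q₁ + (q₂ + 0ℚ))))
    + (q₀ * ((1ℚ - D) * ((1ℚ - D) * ((1ℚ - D) * 1ℚ)))
      + (q₁ * ((1ℚ - D) * ((1ℚ - D) * 1ℚ)) + (q₂ * ((1ℚ - D) * 1ℚ) + 0ℚ)))
  ≡ 1ℚ - D * (q₀ * ℕtoℚ 3 + (q₁ * ℕtoℚ 2 + (q₂ * 1ℚ + (q₃ * 0ℚ + 0ℚ))))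
      + D * D * (q₀ * ℕtoℚ 3 + (q₁ * 1ℚ + (q₂ * 0ℚ + (q₃ * 0ℚ + 0ℚ))))
      - D * D * D * (q₀ * 1ℚ + (q₁ * 0ℚ + (q₂ * 0ℚ + (q₃ * 0ℚ + 0ℚ))))
bracket-by-rows = solve-∀ ℚ-ring

rhs-closedForm : ∀ n p → rhs n p ≡ ℕtoℚ (n C 3) * triangleProbability p (n ℕ.∸ 3)
rhs-closedForm n p = cong (ℕtoℚ (n C 3) *_) (begin
  bracket (binAtLeast1 M (p * ⅙))
    ≡⟨ cong bracket (trans (binAtLeast1-complement M (p * ⅙)) (cong (λ b → 1ℚ - b ^ℚ M) (one-pair p))) ⟩
  bracket (1ℚ - D)
    ≡⟨ bracket-by-rows (q 0F) (q 1F) (q 2F) (q 3F) D ⟩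
  1ℚ - D * row 1F + D * D * row 2F - D * D * D * row 3F
    ≡⟨ cong₂ (λ s r₃ → s - D * D * D * r₃)
             (cong₂ (λ r₁ r₂ → 1ℚ - D * r₁ + D * D * r₂) (eigen-row 1F) (eigen-row 2F)) (eigen-row 3F) ⟩
  1ℚ - D * (a 1 ^ℚ N * ℕtoℚ 3) + D * D * (a 2 ^ℚ N * ℕtoℚ 3) - D * D * D * (a 3 ^ℚ N * 1ℚ)
    ≡⟨ collect (a 1 ^ℚ N) (a 2 ^ℚ N) (a 3 ^ℚ N) D ⟩
  triangleProbability p N ∎)
  where
  open ≡-Reasoning
  N M : ℕ
  N = n ℕ.∸ 3
  M = N C 2
  a : ℕ → ℚ
  a = avoidChance p
  D : ℚ
  D = a 1 ^ℚ M
  q : Fin 4 → ℚ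
  q = matPow (transP p) N 0F
  bracket : ℚ → ℚ
  bracket B = (1ℚ - (q 0F + (q 1F + (q 2F + 0ℚ)))) + (q 0F * B ^ℚ 3 + (q 1F * B ^ℚ 2 + (q 2F * B ^ℚ 1 + 0ℚ)))
  row : Fin 4 → ℚ
  row m = (matPow (transP p) N · eigenvector m) 0F
  eigen-row : ∀ m → row m ≡ a (toℕ m) ^ℚ N * eigenvector m 0F
  eigen-row m = matPow-eigen (transP p) (eigenvector m) (a (toℕ m)) (transP-eigen p m) N 0F
  one-pair : ∀ p → 1ℚ - p * ⅙ ≡ 1ℚ - ℕtoℚ 1 * (p * ⅙)
  one-pair = solve-∀ ℚ-ring
  collect : ∀ K₁ K₂ K₃ D →
    1ℚ - D * (K₁ * ℕtoℚ 3) + D * D * (K₂ * ℕtoℚ 3) - D * D * D * (K₃ * 1ℚ)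
      ≡ 1ℚ - ℕtoℚ 3 * (D * K₁) + ℕtoℚ 3 * (D * D * K₂) - D * D * D * K₃
  collect = solve-∀ ℚ-ring

expectedTriangles-sum : ∀ n p →
  expectedTriangles n p
    ≡ sumℚ (map (λ T → expectOver p (quads n) (λ es → 𝟙ℚ (isTriangle es T))) (combinations 3 [ n ]))
expectedTriangles-sum n p = trans
  (expectOver-cong p (quads n) (λ es →
    trans (cong ℕtoℚ (numTriangles-count n es)) (ℕtoℚ-count (isTriangle es) (combinations 3 [ n ]))))
  (expectOver-sum p (quads n) (λ T es → 𝟙ℚ (isTriangle es T)) (combinations 3 [ n ]))

-- The identity is polynomial in p and holds for every n.
theorem1p11 : (n : ℕ) → n ≥ 4 → (p : ℚ) → 0ℚ ≤ p → p ≤ 1ℚ →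
    expectedTriangles n p ≡ rhs n p
theorem1p11 n _ p _ _ = begin
  expectedTriangles n p
    ≡⟨ expectedTriangles-sum n p ⟩
  sumℚ (map (λ T → expectOver p (quads n) (λ es → 𝟙ℚ (isTriangle es T))) (combinations 3 [ n ]))
    ≡⟨ sumℚ-map-const (All.map (λ {T} → triangle-probability n p T) (combinations-⊆ 3 [ n ])) ⟩
  ℕtoℚ (length (combinations 3 [ n ])) * triangleProbability p (n ℕ.∸ 3)
    ≡⟨ cong (λ c → ℕtoℚ c * triangleProbability p (n ℕ.∸ 3))
            (trans (length-combinations 3 [ n ]) (cong (_C 3) (length-[n] n))) ⟩
  ℕtoℚ (n C 3) * triangleProbability p (n ℕ.∸ 3)
    ≡⟨ rhs-closedForm n p ⟨
  rhs n p ∎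
  where open ≡-Reasoning
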